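{- Let $A$ be any cirquent and $B$ its purification. Then: (1) if $B$ is provable in $\mathbf{CL16}$, then so is $A$; (2) $A$ is valid iff $B$ is valid; (3) $B$ is pure; (4) $\overline{B}\le\overline{A}$.
   Context: Syntax. Elementary letters $p,q,\ldots$; literals $p,\neg p$. Two fixed disjoint infinite sets of disjunctive and conjunctive clusters. Cirquents: $\top$, $\bot$, literals; $A\vee B$, $A\wedge B$, $A\sqcap^cB$ ($c$ conjunctive), $A\sqcup^cB$ ($c$ disjunctive). A cluster $c$ occurs in a cirquent if $\sqcap^c$ or $\sqcup^c$ occurs in it. A surface occurrence of a subcirquent or connective is one not in the scope of any choice connective $\sqcap^c,\sqcup^c$. $A_1\vee\cdots\vee A_n$ ($n\ge2$) denotes any $\vee$-combination of $A_1,\ldots,A_n$ in this left-to-right order with any bracketing; similarly for $\wedge$. Semantics. A run is a sequence of moves labeled $\top$ (machine) or $\bot$ (environment); it is legal iff every move is $c.0$ or $c.1$ for a cluster $c$, moves in disjunctive clusters are $\top$-labeled, those in conjunctive clusters $\bot$-labeled, and each cluster has at most one move; an illegal run is lost by the player making the first illegal move. For legal $\Gamma$, $A\sqcup^cB$/$A\sqcap^cB$ is resolved if $\Gamma$ contains $c.0$ (resolvent $A$) or $c.1$ (resolvent $B$). An interpretation $^*$ assigns $p^*\in\{\top,\bot\}$. Legal $\Gamma$ is won in $C^*$ iff: $C=\top$; or $C=p$ with $p^*=\top$ or $C=\neg p$ with $p^*=\bot$; or $C=A_0\vee A_1$ (resp. $A_0\wedge A_1$) and $\Gamma$ is won in some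 (resp. both) $A_i^*$; or $C=A_0\sqcup^cA_1$ is resolved and $\Gamma$ is won in the resolvent; or $C=A_0\sqcap^cA_1$ is unresolved or $\Gamma$ is won in its resolvent. An HPM is a Turing machine with an extra read-only run tape showing the current run, able to make moves, while the environment may move at any time; it solves $C^*$ if every run it can generate is won in $C^*$. $C$ is valid iff a single HPM solves $C^*$ for every $^*$. System $\mathbf{CL16}$ ($X[E_1,\ldots,E_n]$: cirquent with fixed subcirquents; $X[F_1,\ldots,F_n]$: all occurrences of $E_i$ replaced by $F_i$; the conclusion sets the context). Axiom: $\top$. Rules (premise(s) $\leadsto$ conclusion): Commutativity $X[B\vee A]\leadsto X[A\vee B]$, $X[B\wedge A]\leadsto X[A\wedge B]$; Associativity $X[A\vee(B\vee C)]\leadsto X[(A\vee B)\vee C]$, $X[A\wedge(B\wedge C)]\leadsto X[(A\wedge B)\wedge C]$; Identity $X[A]\leadsto X[A\vee\bot]$, $X[A]\leadsto X[A\wedge\top]$; Domination $X[\top]\leadsto X[A\vee\top]$, $X[\bot]\leadsto X[A\wedge\bot]$; Choosing $X[A_1,\ldots,A_n]\leadsto X[A_1\sqcup^cB_1,\ldots,A_n\sqcup^cB_n]$ and $X[B_1,\ldots,B_n]\leadsto X[A_1\sqcup^cB_1,\ldots,A_n\sqcup^cB_n]$, these being all $\sqcup^c$-rooted subcirquents of the conclusion; Cleansing $X[Y[A]\sqcap^cC]\leadsto X[Y[A\sqcap^cB]\sqcap^cC]$, $X[C\sqcap^cY[B]]\leadsto X[C\sqcap^cY[A\sqcap^cB]]$;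 Distribution $X[(A\vee C)\wedge(B\vee C)]\leadsto X[(A\wedge B)\vee C]$, $X[(A\vee C)\sqcap^c(B\vee C)]\leadsto X[(A\sqcap^cB)\vee C]$; Trivialization $X[\top]\leadsto X[\neg p\vee p]$; Quadrilemma $X\bigl[\bigl((A\wedge(C\sqcap^bD))\sqcap^a(B\wedge(C\sqcap^bD))\bigr)\sqcap^c\bigl(((A\sqcap^aB)\wedge C)\sqcap^b((A\sqcap^aB)\wedge D)\bigr)\bigr]\leadsto X[(A\sqcap^aB)\wedge(C\sqcap^bD)]$, $c$ not occurring in the conclusion; Splitting $A,B\leadsto A\sqcap^cB$, $c$ occurring in neither $A$ nor $B$. A proof of $A$ is a sequence starting with $\top$, ending with $A$, each later member following by a rule from earlier ones. Rank: ${}^1a=a$, ${}^{n+1}a=a^{({}^na)}$; $\overline{C}=1$ for $\top,\bot$, literals; $\overline{A\sqcup^cB}=\overline{A\sqcap^cB}=\overline{A}+\overline{B}$; $\overline{A\wedge B}=5^{\overline{A}+\overline{B}}$; $\overline{A\vee B}={}^{(\overline{A}+\overline{B})}5$. Pure: $D$ is pure iff (1) $D$ has no surface occurrence of $\bot$ unless $D=\bot$; (2) no surface occurrence of $\wedge$ is in the scope of $\vee$; (3) no surface occurrence of any $\sqcap^c$ is in the scope of $\vee$; (4) there is no surface occurrence of a subcirquent $A_1\vee\cdots\vee A_n$ with both $p$ and $\neg p$ among the $A_i$ for some letter $p$; (5) no surface occurrence of $\top$ unless $D=\top$; (6) if $D$ is $A_1\wedge\cdots\wedge A_n$ ($n\ge2$),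 some $A_i$ is not of the form $B\sqcap^cC$; (7) if $D$ is $A\sqcap^cB$, the cluster $c$ occurs in neither $A$ nor $B$. Purification procedure applied to $D$: Stages 1–7 are executed in order; each stage is a loop repeated until it no longer modifies $D$, then the next stage begins; after Stage 7 the current $D$ is returned. Stage 1: replace a surface occurrence of $\bot\vee A$ or $A\vee\bot$ by $A$; then replace a surface occurrence of $\bot\wedge A$ or $A\wedge\bot$ by $\bot$. Stage 2: replace a surface occurrence of $(A\wedge B)\vee C$ or $C\vee(A\wedge B)$ by $(A\vee C)\wedge(B\vee C)$. Stage 3: replace a surface occurrence of $(A\sqcap^cB)\vee C$ or $C\vee(A\sqcap^cB)$ by $(A\vee C)\sqcap^c(B\vee C)$. Stage 4: replace a surface occurrence of $A_1\vee\cdots\vee A_n$ with both $p$ and $\neg p$ among the $A_i$ by $\top$. Stage 5: replace a surface occurrence of $\top\vee A$ or $A\vee\top$ by $\top$; then replace a surface occurrence of $\top\wedge A$ or $A\wedge\top$ by $A$. Stage 6: replace a surface occurrence of $(A\sqcap^aB)\wedge(E\sqcap^bF)$ by $\bigl((A\wedge(E\sqcap^bF))\sqcap^a(B\wedge(E\sqcap^bF))\bigr)\sqcap^c\bigl(((A\sqcap^aB)\wedge E)\sqcap^b((A\sqcap^aB)\wedge F)\bigr)$, where $c$ is a conjunctive cluster not occurring in $D$. Stage 7: if $D$ is $X[E\sqcap^cF]\sqcap^cA$ change it to $X[E]\sqcap^cA$; if $D$ is $A\sqcap^cX[E\sqcap^cF]$ change it to $A\sqcap^cX[F]$. The procedure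 terminates; the purification of $A$ is the value returned when the procedure is applied to $D=A$. -}

module Defs where

open import Data.Nat using (ℕ; zero; suc; _+_; _^_; _≡ᵇ_)
open import Data.Bool as B using (Bool; true; false; not; if_then_else_)
open import Data.List using (List; []; _∷_; _++_; [_])
open import Data.List.Membership.Propositional using (_∈_)
open import Data.Maybe using (Maybe; just; nothing)
open import Data.Product using (Σ; ∃; ∃-syntax; _×_; _,_; proj₁; proj₂)
open import Data.Sum using (_⊎_)
open import Relation.Nullary using (¬_)
open import Relation.Binary.PropositionalEquality using (_≡_; _≢_)

-- Syntax
-- ⊓ᶜ n A B  is  A ⊓^c B  where c is the n-th conjunctive cluster,
-- ⊔ᶜ n A B  is  A ⊔^c B  where c is the n-th disjunctive cluster.

data Cirq : Set where
  ⊤ᶜ ⊥ᶜ   : Cirq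
  pos neg : ℕ → Cirq
  _∨ᶜ_ _∧ᶜ_ : Cirq → Cirq → Cirq
  ⊓ᶜ ⊔ᶜ   : ℕ → Cirq → Cirq → Cirq

infixr 6 _∧ᶜ_
infixr 5 _∨ᶜ_

data Cluster : Set where
  conj disj : ℕ → Cluster

data Occurs : Cluster → Cirq → Set where
  here⊓ : ∀ {n A B} → Occurs (conj n) (⊓ᶜ n A B)
  here⊔ : ∀ {n A B} → Occurs (disj n) (⊔ᶜ n A B)
  ∨l : ∀ {c A B} → Occurs c A → Occurs c (A ∨ᶜ B)
  ∨r : ∀ {c A B} → Occurs c B → Occurs c (A ∨ᶜ B)
  ∧l : ∀ {c A B} → Occurs c A → Occurs c (A ∧ᶜ B)
  ∧r : ∀ {c A B} → Occurs c B → Occurs c (A ∧ᶜ B)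
  ⊓l : ∀ {c n A B} → Occurs c A → Occurs c (⊓ᶜ n A B)
  ⊓r : ∀ {c n A B} → Occurs c B → Occurs c (⊓ᶜ n A B)
  ⊔l : ∀ {c n A B} → Occurs c A → Occurs c (⊔ᶜ n A B)
  ⊔r : ∀ {c n A B} → Occurs c B → Occurs c (⊔ᶜ n A B)

data Ctx : Set where
  ∙ : Ctx
  ∨L ∨R ∧L ∧R : Ctx → Cirq → Ctx
  ⊓L ⊓R ⊔L ⊔R : ℕ → Ctx → Cirq → Ctx

plug : Ctx → Cirq → Cirq
plug ∙ E = E
plug (∨L X B) E = plug X E ∨ᶜ B
plug (∨R X A) E = A ∨ᶜ plug X E
plug (∧L X B) E = plug X E ∧ᶜ B
plug (∧R X A) E = A ∧ᶜ plug X E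
plug (⊓L n X B) E = ⊓ᶜ n (plug X E) B
plug (⊓R n X A) E = ⊓ᶜ n A (plug X E)
plug (⊔L n X B) E = ⊔ᶜ n (plug X E) B
plug (⊔R n X A) E = ⊔ᶜ n A (plug X E)

-- surface contexts (hole not in the scope of any choice connective)
data SCtx : Set where
  ∙ : SCtx
  ∨L ∨R ∧L ∧R : SCtx → Cirq → SCtx

splug : SCtx → Cirq → Cirq
splug ∙ E = E
splug (∨L X B) E = splug X E ∨ᶜ B
splug (∨R X A) E = A ∨ᶜ splug X E
splug (∧L X B) E = splug X E ∧ᶜ B
splug (∧R X A) E = A ∧ᶜ splug X E

Surf : Cirq → Cirq → Set
Surf D E = ∃[ X ] (D ≡ splug X E)

-- E is one of the A_i in some representation D = A_1 ∨ ... ∨ A_n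
-- (reachable from D through ∨ only; D itself included)
data VComp : Cirq → Cirq → Set where
  self : ∀ {E} → VComp E E
  ∨l : ∀ {A B E} → VComp A E → VComp (A ∨ᶜ B) E
  ∨r : ∀ {A B E} → VComp B E → VComp (A ∨ᶜ B) E

IsAnd : Cirq → Set
IsAnd F = ∃[ A ] ∃[ B ] (F ≡ A ∧ᶜ B)

IsMeet : Cirq → Set
IsMeet F = ∃[ n ] ∃[ A ] ∃[ B ] (F ≡ ⊓ᶜ n A B)

data ConjLeaf : Cirq → Cirq → Set where
  leaf : ∀ {F} → ¬ IsAnd F → ConjLeaf F F
  ∧l : ∀ {A B F} → ConjLeaf A F → ConjLeaf (A ∧ᶜ B) F
  ∧r : ∀ {A B F} → ConjLeaf B F → ConjLeaf (A ∧ᶜ B) F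

tower : ℕ → ℕ → ℕ          -- tower n a = ⁿa  (with ⁰a = 1, so ¹a = a)
tower zero a = 1
tower (suc n) a = a ^ tower n a

rank : Cirq → ℕ
rank ⊤ᶜ = 1
rank ⊥ᶜ = 1
rank (pos _) = 1
rank (neg _) = 1
rank (⊓ᶜ _ A B) = rank A + rank B
rank (⊔ᶜ _ A B) = rank A + rank B
rank (A ∧ᶜ B) = 5 ^ (rank A + rank B)
rank (A ∨ᶜ B) = tower (rank A + rank B) 5

record Pure (D : Cirq) : Set where
  field
    p1 : D ≢ ⊥ᶜ → ¬ Surf D ⊥ᶜ
    p2 : ∀ X Y → Surf D (X ∨ᶜ Y) → ∀ E F →
         ¬ (Surf X (E ∧ᶜ F) ⊎ Surf Y (E ∧ᶜ F))
    p3 : ∀ X Y → Surf D (X ∨ᶜ Y) → ∀ n E F →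
         ¬ (Surf X (⊓ᶜ n E F) ⊎ Surf Y (⊓ᶜ n E F))
    p4 : ∀ E p → Surf D E → ¬ (VComp E (pos p) × VComp E (neg p))
    p5 : D ≢ ⊤ᶜ → ¬ Surf D ⊤ᶜ
    p6 : IsAnd D → ∃[ F ] (ConjLeaf D F × ¬ IsMeet F)
    p7 : ∀ n A B → D ≡ ⊓ᶜ n A B → ¬ Occurs (conj n) A × ¬ Occurs (conj n) B

-- local rules: Local P Q means  X[P] ⇝ X[Q]  (premise P, conclusion Q)
data Local : Cirq → Cirq → Set where
  comm∨ : ∀ A B → Local (B ∨ᶜ A) (A ∨ᶜ B)
  comm∧ : ∀ A B → Local (B ∧ᶜ A) (A ∧ᶜ B)
  assoc∨ : ∀ A B C → Local (A ∨ᶜ (B ∨ᶜ C)) ((A ∨ᶜ B) ∨ᶜ C)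
  assoc∧ : ∀ A B C → Local (A ∧ᶜ (B ∧ᶜ C)) ((A ∧ᶜ B) ∧ᶜ C)
  ident∨ : ∀ A → Local A (A ∨ᶜ ⊥ᶜ)
  ident∧ : ∀ A → Local A (A ∧ᶜ ⊤ᶜ)
  domin∨ : ∀ A → Local ⊤ᶜ (A ∨ᶜ ⊤ᶜ)
  domin∧ : ∀ A → Local ⊥ᶜ (A ∧ᶜ ⊥ᶜ)
  distr∧ : ∀ A B C → Local ((A ∨ᶜ C) ∧ᶜ (B ∨ᶜ C)) ((A ∧ᶜ B) ∨ᶜ C)
  distr⊓ : ∀ c A B C → Local (⊓ᶜ c (A ∨ᶜ C) (B ∨ᶜ C)) (⊓ᶜ c A B ∨ᶜ C)
  trivial : ∀ p → Local ⊤ᶜ (neg p ∨ᶜ pos p)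

choose : ℕ → Bool → Cirq → Cirq
choose n b ⊤ᶜ = ⊤ᶜ
choose n b ⊥ᶜ = ⊥ᶜ
choose n b (pos p) = pos p
choose n b (neg p) = neg p
choose n b (A ∨ᶜ B) = choose n b A ∨ᶜ choose n b B
choose n b (A ∧ᶜ B) = choose n b A ∧ᶜ choose n b B
choose n b (⊓ᶜ m A B) = ⊓ᶜ m (choose n b A) (choose n b B)
choose n b (⊔ᶜ m A B) =
  if m ≡ᵇ n then (if b then choose n b B else choose n b A)
  else ⊔ᶜ m (choose n b A) (choose n b B)

quadPrem : ℕ → ℕ → ℕ → Cirq → Cirq → Cirq → Cirq → Cirq
quadPrem a b c A B C D =
  ⊓ᶜ c (⊓ᶜ a (A ∧ᶜ ⊓ᶜ b C D) (B ∧ᶜ ⊓ᶜ b C D))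
       (⊓ᶜ b (⊓ᶜ a A B ∧ᶜ C) (⊓ᶜ a A B ∧ᶜ D))

data Prov : Cirq → Set where
  axiom : Prov ⊤ᶜ
  local : ∀ X {P Q} → Local P Q → Prov (plug X P) → Prov (plug X Q)
  choosing : ∀ n b C → Prov (choose n b C) → Prov C
  cleanseL : ∀ X Y c A B C →
    Prov (plug X (⊓ᶜ c (plug Y A) C)) →
    Prov (plug X (⊓ᶜ c (plug Y (⊓ᶜ c A B)) C))
  cleanseR : ∀ X Y c A B C →
    Prov (plug X (⊓ᶜ c C (plug Y B))) →
    Prov (plug X (⊓ᶜ c C (plug Y (⊓ᶜ c A B))))
  quadrilemma : ∀ X a b c A B C D →
    ¬ Occurs (conj c) (plug X (⊓ᶜ a A B ∧ᶜ ⊓ᶜ b C D)) →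
    Prov (plug X (quadPrem a b c A B C D)) →
    Prov (plug X (⊓ᶜ a A B ∧ᶜ ⊓ᶜ b C D))
  splitting : ∀ c A B → ¬ Occurs (conj c) A → ¬ Occurs (conj c) B →
    Prov A → Prov B → Prov (⊓ᶜ c A B)

data Player : Set where
  machine env : Player

Move : Set
Move = Cluster × Bool       -- c.0 = (c , false), c.1 = (c , true)

LMove : Set
LMove = Player × Move

owner : Cluster → Player
owner (conj _) = env
owner (disj _) = machine

_==P_ : Player → Player → Bool
machine ==P machine = true
env ==P env = true
_ ==P _ = false

_==C_ : Cluster → Cluster → Bool
conj m ==C conj n = m ≡ᵇ n
disj m ==C disj n = m ≡ᵇ n
_ ==C _ = false

elemC : Cluster → List Cluster → Bool
elemC c [] = false
elemC c (d ∷ ds) = (c ==C d) B.∨ elemC c ds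

-- the player who made the first illegal move, if any
-- (first argument: clusters already moved in)
firstIllegal : List Cluster → List LMove → Maybe Player
firstIllegal seen [] = nothing
firstIllegal seen ((p , c , b) ∷ rest) =
  if (owner c ==P p) B.∧ not (elemC c seen)
  then firstIllegal (c ∷ seen) rest
  else just p

-- winning a legal run in C*, given the resolution relation of the run
Won : (ℕ → Bool) → (Cluster → Bool → Set) → Cirq → Set
Won I R ⊤ᶜ = Data.Unit.⊤ where import Data.Unit
Won I R ⊥ᶜ = Data.Empty.⊥ where import Data.Empty
Won I R (pos p) = I p ≡ true
Won I R (neg p) = I p ≡ false
Won I R (A ∨ᶜ B) = Won I R A ⊎ Won I R B
Won I R (A ∧ᶜ B) = Won I R A × Won I R B
Won I R (⊔ᶜ n A B) =
  (R (disj n) false × Won I R A) ⊎ (R (disj n) true × Won I R B)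
Won I R (⊓ᶜ n A B) =
  ((¬ R (conj n) false × ¬ R (conj n) true) ⊎ (R (conj n) false × Won I R A))
  ⊎ (R (conj n) true × Won I R B)

-- a (possibly infinite) run given by its increasing finite prefixes Γ t
Resolved : (ℕ → List LMove) → Cluster → Bool → Set
Resolved Γ c b = ∃[ t ] ∃[ p ] ((p , c , b) ∈ Γ t)

WonRun : (ℕ → Bool) → Cirq → (ℕ → List LMove) → Set
WonRun I C Γ =
  (∃[ t ] (firstIllegal [] (Γ t) ≡ just env))
  ⊎ ((∀ t → firstIllegal [] (Γ t) ≡ nothing) × Won I (Resolved Γ) C)

-- abstract HPM: a deterministic machine which, at each computation step,
-- sees its state and the current run and may make one move
record HPM : Set₁ where
  field
    State : Set
    start : State
    step  : State → List LMove → State × Maybe Move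

envMoves : List Move → List LMove
envMoves [] = []
envMoves (m ∷ ms) = (env , m) ∷ envMoves ms

myMove : Maybe Move → List LMove
myMove nothing = []
myMove (just m) = [ (machine , m) ]

-- configuration after t steps against environment behaviour e
-- (e t = the moves the environment makes just before machine step t)
config : (M : HPM) → (ℕ → List Move) → ℕ → HPM.State M × List LMove
config M e zero = HPM.start M , []
config M e (suc t) =
  let s  = proj₁ (config M e t)
      Γ' = proj₂ (config M e t) ++ envMoves (e t)
      r  = HPM.step M s Γ'
  in proj₁ r , Γ' ++ myMove (proj₂ r)

Solves : HPM → Cirq → (ℕ → Bool) → Set
Solves M C I = ∀ (e : ℕ → List Move) → WonRun I C (λ t → proj₂ (config M e t))

Valid : Cirq → Set₁
Valid C = Σ HPM λ M → ∀ (I : ℕ → Bool) → Solves M C I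

-- Purification procedure (as a relation: all possible executions)

data R1a : Cirq → Cirq → Set where
  l : ∀ A → R1a (⊥ᶜ ∨ᶜ A) A
  r : ∀ A → R1a (A ∨ᶜ ⊥ᶜ) A
data R1b : Cirq → Cirq → Set where
  l : ∀ A → R1b (⊥ᶜ ∧ᶜ A) ⊥ᶜ
  r : ∀ A → R1b (A ∧ᶜ ⊥ᶜ) ⊥ᶜ
data R2 : Cirq → Cirq → Set where
  l : ∀ A B C → R2 ((A ∧ᶜ B) ∨ᶜ C) ((A ∨ᶜ C) ∧ᶜ (B ∨ᶜ C))
  r : ∀ A B C → R2 (C ∨ᶜ (A ∧ᶜ B)) ((A ∨ᶜ C) ∧ᶜ (B ∨ᶜ C))
data R3 : Cirq → Cirq → Set where
  l : ∀ c A B C → R3 (⊓ᶜ c A B ∨ᶜ C) (⊓ᶜ c (A ∨ᶜ C) (B ∨ᶜ C))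
  r : ∀ c A B C → R3 (C ∨ᶜ ⊓ᶜ c A B) (⊓ᶜ c (A ∨ᶜ C) (B ∨ᶜ C))
data R4 : Cirq → Cirq → Set where
  tr : ∀ E p → VComp E (pos p) → VComp E (neg p) → R4 E ⊤ᶜ
data R5a : Cirq → Cirq → Set where
  l : ∀ A → R5a (⊤ᶜ ∨ᶜ A) ⊤ᶜ
  r : ∀ A → R5a (A ∨ᶜ ⊤ᶜ) ⊤ᶜ
data R5b : Cirq → Cirq → Set where
  l : ∀ A → R5b (⊤ᶜ ∧ᶜ A) A
  r : ∀ A → R5b (A ∧ᶜ ⊤ᶜ) A

data SurfRw (R : Cirq → Cirq → Set) : Cirq → Cirq → Set where
  rw : ∀ X {P Q} → R P Q → SurfRw R (splug X P) (splug X Q)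

data Step6 : Cirq → Cirq → Set where
  st : ∀ X a b c A B E F →
    ¬ Occurs (conj c) (splug X (⊓ᶜ a A B ∧ᶜ ⊓ᶜ b E F)) →
    Step6 (splug X (⊓ᶜ a A B ∧ᶜ ⊓ᶜ b E F))
          (splug X (quadPrem a b c A B E F))

data Step7a : Cirq → Cirq → Set where
  st : ∀ X c E F A → Step7a (⊓ᶜ c (plug X (⊓ᶜ c E F)) A) (⊓ᶜ c (plug X E) A)
data Step7b : Cirq → Cirq → Set where
  st : ∀ X c E F A → Step7b (⊓ᶜ c A (plug X (⊓ᶜ c E F))) (⊓ᶜ c A (plug X F))

Opt : (Cirq → Cirq → Set) → Cirq → Cirq → Set
Opt S D D' = S D D' ⊎ (D' ≡ D × (∀ D'' → ¬ S D D''))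

Seq2 : (Cirq → Cirq → Set) → (Cirq → Cirq → Set) → Cirq → Cirq → Set
Seq2 S T D D' = ∃[ M ] (Opt S D M × Opt T M D')

data Loop (It : Cirq → Cirq → Set) : Cirq → Cirq → Set where
  stop : ∀ {D} → It D D → Loop It D D
  again : ∀ {D D' E} → It D D' → D' ≢ D → Loop It D' E → Loop It D E

Stage1 Stage2 Stage3 Stage4 Stage5 Stage6 Stage7 : Cirq → Cirq → Set
Stage1 = Loop (Seq2 (SurfRw R1a) (SurfRw R1b))
Stage2 = Loop (Opt (SurfRw R2))
Stage3 = Loop (Opt (SurfRw R3))
Stage4 = Loop (Opt (SurfRw R4))
Stage5 = Loop (Seq2 (SurfRw R5a) (SurfRw R5b))
Stage6 = Loop (Opt Step6)
Stage7 = Loop (Seq2 Step7a Step7b)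

Purification : Cirq → Cirq → Set
Purification A B =
  ∃[ D1 ] ∃[ D2 ] ∃[ D3 ] ∃[ D4 ] ∃[ D5 ] ∃[ D6 ]
    (Stage1 A D1 × Stage2 D1 D2 × Stage3 D2 D3 × Stage4 D3 D4 ×
     Stage5 D4 D5 × Stage6 D5 D6 × Stage7 D6 B)

{-# OPTIONS --safe #-}
-- Each stage of the purification procedure rewrites one surface subcirquent at a time, so every
-- claim reduces to a statement about single rewrite steps, carried through the loops of the
-- procedure by PurificationSteps.
--
-- Read backwards, every step is a CL16 derivation: Identity, Domination, Distribution,
-- Quadrilemma and Cleansing directly, and Stage 4 via Trivialization and the structural rules.
-- No step increases the rank, by elementary estimates on towers of 5s. For validity: on a legal
-- run each cluster is resolved at most once, and on the runs of a machine that never moves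
-- illegally first it is decidable whether a cluster is resolved; with these two facts every step
-- except the converse of Quadrilemma turns a win into a win on the same run. For that converse the new
-- machine runs the old one on a relabelled copy of the run in which the fresh cluster c is
-- resolved just before the environment's first move in a or b. Purity holds because each stage
-- establishes a shape invariant that the later stages keep, and each loop stops only when none of
-- its rewrites applies.

module Submission where

open import Defs
open import Level using (Level)
open import Data.Nat as ℕ using (ℕ; zero; suc; _+_; _*_; _^_; _≤_; _<_; z≤n; s≤s; _≟_; _<?_)
open import Data.Nat.Properties
open import Data.Nat.Tactic.RingSolver using (solve-∀)
open import Data.Empty using (⊥; ⊥-elim)
open import Data.Unit using (⊤; tt)
open import Data.Product using (Σ; ∃-syntax; _×_; _,_; proj₁; proj₂)
open import Data.Sum using (_⊎_; inj₁; inj₂; [_,_]′)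
open import Data.Bool as Bool using (Bool; true; false; not)
open import Data.Bool.Properties using (∧-conicalˡ; ∧-conicalʳ; ∨-conicalʳ; ∨-zeroʳ; not-involutive)
open import Data.Maybe using (Maybe; just; nothing)
open import Data.List using (List; []; _∷_; _++_)
open import Data.List.Membership.Propositional using (_∈_)
open import Data.List.Membership.Propositional.Properties using (∈-++⁺ˡ; ∈-++⁺ʳ; ∈-++⁻)
open import Data.List.Relation.Unary.Any using (here; there)
open import Relation.Nullary using (¬_; Dec; yes; no)
open import Relation.Binary.Core using (Rel; _⇒_)
open import Relation.Binary.Definitions using (Reflexive; Transitive)
open import Relation.Binary.PropositionalEquality
open import Function using (id; _∘_; _⇔_; mk⇔; Equivalence)
open import Function.Properties.Equivalence using () renaming (refl to ⇔-refl; trans to ⇔-trans)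

private variable
  ℓ : Level
  S S₁ S₂ It : Cirq → Cirq → Set

toCtx : SCtx → Ctx
toCtx ∙ = ∙
toCtx (∨L X B) = ∨L (toCtx X) B
toCtx (∨R X A) = ∨R (toCtx X) A
toCtx (∧L X B) = ∧L (toCtx X) B
toCtx (∧R X A) = ∧R (toCtx X) A

splug≡plug : ∀ X P → splug X P ≡ plug (toCtx X) P
splug≡plug ∙ P = refl
splug≡plug (∨L X B) P = cong (_∨ᶜ B) (splug≡plug X P)
splug≡plug (∨R X A) P = cong (A ∨ᶜ_) (splug≡plug X P)
splug≡plug (∧L X B) P = cong (_∧ᶜ B) (splug≡plug X P)
splug≡plug (∧R X A) P = cong (A ∧ᶜ_) (splug≡plug X P)

∨ᶜ-injective : ∀ {A B C D} → A ∨ᶜ B ≡ C ∨ᶜ D → A ≡ C × B ≡ D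
∨ᶜ-injective refl = refl , refl

∧ᶜ-injective : ∀ {A B C D} → A ∧ᶜ B ≡ C ∧ᶜ D → A ≡ C × B ≡ D
∧ᶜ-injective refl = refl , refl

splug-injective : ∀ X {P Q} → splug X P ≡ splug X Q → P ≡ Q
splug-injective ∙ e = e
splug-injective (∨L X B) e = splug-injective X (proj₁ (∨ᶜ-injective e))
splug-injective (∨R X A) e = splug-injective X (proj₂ (∨ᶜ-injective e))
splug-injective (∧L X B) e = splug-injective X (proj₁ (∧ᶜ-injective e))
splug-injective (∧R X A) e = splug-injective X (proj₂ (∧ᶜ-injective e))

splug≡⊥ᶜ : ∀ X {P} → splug X P ≡ ⊥ᶜ → P ≡ ⊥ᶜ
splug≡⊥ᶜ ∙ e = e

splug≡⊤ᶜ : ∀ X {P} → splug X P ≡ ⊤ᶜ → P ≡ ⊤ᶜ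
splug≡⊤ᶜ ∙ e = e

Occurs-splug : ∀ X {d P} → Occurs d P → Occurs d (splug X P)
Occurs-splug ∙ o = o
Occurs-splug (∨L X B) o = ∨l (Occurs-splug X o)
Occurs-splug (∨R X A) o = ∨r (Occurs-splug X o)
Occurs-splug (∧L X B) o = ∧l (Occurs-splug X o)
Occurs-splug (∧R X A) o = ∧r (Occurs-splug X o)

_∘ᶜ_ : Ctx → Ctx → Ctx
∙ ∘ᶜ Y = Y
∨L X B ∘ᶜ Y = ∨L (X ∘ᶜ Y) B
∨R X A ∘ᶜ Y = ∨R (X ∘ᶜ Y) A
∧L X B ∘ᶜ Y = ∧L (X ∘ᶜ Y) B
∧R X A ∘ᶜ Y = ∧R (X ∘ᶜ Y) A
⊓L n X B ∘ᶜ Y = ⊓L n (X ∘ᶜ Y) B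
⊓R n X A ∘ᶜ Y = ⊓R n (X ∘ᶜ Y) A
⊔L n X B ∘ᶜ Y = ⊔L n (X ∘ᶜ Y) B
⊔R n X A ∘ᶜ Y = ⊔R n (X ∘ᶜ Y) A

plug-∘ᶜ : ∀ X Y P → plug (X ∘ᶜ Y) P ≡ plug X (plug Y P)
plug-∘ᶜ ∙ Y P = refl
plug-∘ᶜ (∨L X B) Y P = cong (_∨ᶜ B) (plug-∘ᶜ X Y P)
plug-∘ᶜ (∨R X A) Y P = cong (A ∨ᶜ_) (plug-∘ᶜ X Y P)
plug-∘ᶜ (∧L X B) Y P = cong (_∧ᶜ B) (plug-∘ᶜ X Y P)
plug-∘ᶜ (∧R X A) Y P = cong (A ∧ᶜ_) (plug-∘ᶜ X Y P)
plug-∘ᶜ (⊓L n X B) Y P = cong (λ Z → ⊓ᶜ n Z B) (plug-∘ᶜ X Y P)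
plug-∘ᶜ (⊓R n X A) Y P = cong (⊓ᶜ n A) (plug-∘ᶜ X Y P)
plug-∘ᶜ (⊔L n X B) Y P = cong (λ Z → ⊔ᶜ n Z B) (plug-∘ᶜ X Y P)
plug-∘ᶜ (⊔R n X A) Y P = cong (⊔ᶜ n A) (plug-∘ᶜ X Y P)

size : Cirq → ℕ
size (A ∨ᶜ B) = suc (size A + size B)
size (A ∧ᶜ B) = suc (size A + size B)
size (⊓ᶜ _ A B) = suc (size A + size B)
size (⊔ᶜ _ A B) = suc (size A + size B)
size _ = 1

plug-size< : ∀ X {P Q} → size P < size Q → size (plug X P) < size (plug X Q)
plug-size< ∙ h = h
plug-size< (∨L X B) h = s≤s (+-monoˡ-< (size B) (plug-size< X h))
plug-size< (∨R X A) h = s≤s (+-monoʳ-< (size A) (plug-size< X h))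
plug-size< (∧L X B) h = s≤s (+-monoˡ-< (size B) (plug-size< X h))
plug-size< (∧R X A) h = s≤s (+-monoʳ-< (size A) (plug-size< X h))
plug-size< (⊓L n X B) h = s≤s (+-monoˡ-< (size B) (plug-size< X h))
plug-size< (⊓R n X A) h = s≤s (+-monoʳ-< (size A) (plug-size< X h))
plug-size< (⊔L n X B) h = s≤s (+-monoˡ-< (size B) (plug-size< X h))
plug-size< (⊔R n X A) h = s≤s (+-monoʳ-< (size A) (plug-size< X h))

splug-size< : ∀ X {P Q} → size P < size Q → size (splug X P) < size (splug X Q)
splug-size< X {P} {Q} h rewrite splug≡plug X P | splug≡plug X Q = plug-size< (toCtx X) h

conjBound : Cirq → ℕ
conjBound (A ∨ᶜ B) = conjBound A ℕ.⊔ conjBound B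
conjBound (A ∧ᶜ B) = conjBound A ℕ.⊔ conjBound B
conjBound (⊓ᶜ n A B) = suc n ℕ.⊔ (conjBound A ℕ.⊔ conjBound B)
conjBound (⊔ᶜ n A B) = conjBound A ℕ.⊔ conjBound B
conjBound _ = 0

Occurs⇒<conjBound : ∀ {n D} → Occurs (conj n) D → n < conjBound D
Occurs⇒<conjBound {n} (here⊓ {A = A} {B}) = m≤m⊔n (suc n) (conjBound A ℕ.⊔ conjBound B)
Occurs⇒<conjBound (∨l {B = B} o) = m≤n⇒m≤n⊔o (conjBound B) (Occurs⇒<conjBound o)
Occurs⇒<conjBound (∨r {A = A} o) = m≤n⇒m≤o⊔n (conjBound A) (Occurs⇒<conjBound o)
Occurs⇒<conjBound (∧l {B = B} o) = m≤n⇒m≤n⊔o (conjBound B) (Occurs⇒<conjBound o)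
Occurs⇒<conjBound (∧r {A = A} o) = m≤n⇒m≤o⊔n (conjBound A) (Occurs⇒<conjBound o)
Occurs⇒<conjBound (⊓l {n = m} {B = B} o) =
  m≤n⇒m≤o⊔n (suc m) (m≤n⇒m≤n⊔o (conjBound B) (Occurs⇒<conjBound o))
Occurs⇒<conjBound (⊓r {n = m} {A} o) =
  m≤n⇒m≤o⊔n (suc m) (m≤n⇒m≤o⊔n (conjBound A) (Occurs⇒<conjBound o))
Occurs⇒<conjBound (⊔l {B = B} o) = m≤n⇒m≤n⊔o (conjBound B) (Occurs⇒<conjBound o)
Occurs⇒<conjBound (⊔r {A = A} o) = m≤n⇒m≤o⊔n (conjBound A) (Occurs⇒<conjBound o)

conjBound-fresh : ∀ D → ¬ Occurs (conj (conjBound D)) D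
conjBound-fresh D o = <-irrefl refl (Occurs⇒<conjBound o)

module _ {_∼_ : Rel Cirq ℓ} where

  Opt⇒ : Reflexive _∼_ → S ⇒ _∼_ → Opt S ⇒ _∼_
  Opt⇒ ∼-refl f (inj₁ s) = f s
  Opt⇒ ∼-refl f (inj₂ (refl , _)) = ∼-refl

  Seq2⇒ : Reflexive _∼_ → Transitive _∼_ → S₁ ⇒ _∼_ → S₂ ⇒ _∼_ → Seq2 S₁ S₂ ⇒ _∼_
  Seq2⇒ ∼-refl ∼-trans f g (_ , s , t) = ∼-trans (Opt⇒ ∼-refl f s) (Opt⇒ ∼-refl g t)

  Loop⇒ : Transitive _∼_ → It ⇒ _∼_ → Loop It ⇒ _∼_
  Loop⇒ ∼-trans f (stop s) = f s
  Loop⇒ ∼-trans f (again s _ rest) = ∼-trans (f s) (Loop⇒ ∼-trans f rest)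

Loop-fixpoint : ∀ {D E} → Loop It D E → It E E
Loop-fixpoint (stop s) = s
Loop-fixpoint (again _ _ rest) = Loop-fixpoint rest

Loop-trivial : ∀ {D E} → (∀ {D′} → It D D′ → D′ ≡ D) → Loop It D E → E ≡ D
Loop-trivial f (stop _) = refl
Loop-trivial f (again s D′≢D _) = ⊥-elim (D′≢D (f s))

Opt-stuck : (∀ {D} → ¬ S D D) → ∀ {D} → Opt S D D → ∀ D′ → ¬ S D D′
Opt-stuck S-irrefl (inj₁ s) = ⊥-elim (S-irrefl s)
Opt-stuck S-irrefl (inj₂ (_ , stuck)) = stuck

Seq2-stuck : (μ : Cirq → ℕ) → (∀ {D D′} → S₁ D D′ → μ D′ < μ D) → (∀ {D D′} → S₂ D D′ → μ D′ < μ D) →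
  ∀ {D} → Seq2 S₁ S₂ D D → (∀ D′ → ¬ S₁ D D′) × (∀ D′ → ¬ S₂ D D′)
Seq2-stuck μ S₁< S₂< (_ , inj₁ s , inj₁ t) = ⊥-elim (<-asym (S₁< s) (S₂< t))
Seq2-stuck μ S₁< S₂< (_ , inj₁ s , inj₂ (refl , _)) = ⊥-elim (<-irrefl refl (S₁< s))
Seq2-stuck μ S₁< S₂< (_ , inj₂ (refl , _) , inj₁ t) = ⊥-elim (<-irrefl refl (S₂< t))
Seq2-stuck μ S₁< S₂< (_ , inj₂ (refl , S₁-stuck) , inj₂ (_ , S₂-stuck)) = S₁-stuck , S₂-stuck

record PurificationSteps (_∼_ : Rel Cirq ℓ) : Set ℓ where
  field
    ∼-refl : Reflexive _∼_
    ∼-trans : Transitive _∼_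
    step1a : SurfRw R1a ⇒ _∼_
    step1b : SurfRw R1b ⇒ _∼_
    step2 : SurfRw R2 ⇒ _∼_
    step3 : SurfRw R3 ⇒ _∼_
    step4 : SurfRw R4 ⇒ _∼_
    step5a : SurfRw R5a ⇒ _∼_
    step5b : SurfRw R5b ⇒ _∼_
    step6 : Step6 ⇒ _∼_
    step7a : Step7a ⇒ _∼_
    step7b : Step7b ⇒ _∼_

purification⇒ : {_∼_ : Rel Cirq ℓ} → PurificationSteps _∼_ → Purification ⇒ _∼_
purification⇒ {_∼_ = _∼_} ps (_ , _ , _ , _ , _ , _ , s₁ , s₂ , s₃ , s₄ , s₅ , s₆ , s₇) =
  ∼-trans (stage (Seq2⇒ ∼-refl ∼-trans step1a step1b) s₁)
  (∼-trans (stage (Opt⇒ ∼-refl step2) s₂)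
  (∼-trans (stage (Opt⇒ ∼-refl step3) s₃)
  (∼-trans (stage (Opt⇒ ∼-refl step4) s₄)
  (∼-trans (stage (Seq2⇒ ∼-refl ∼-trans step5a step5b) s₅)
  (∼-trans (stage (Opt⇒ ∼-refl step6) s₆)
           (stage (Seq2⇒ ∼-refl ∼-trans step7a step7b) s₇))))))
  where
  open PurificationSteps ps
  stage : It ⇒ _∼_ → Loop It ⇒ _∼_
  stage = Loop⇒ ∼-trans

infix 4 _⇝_ _⊒_
_⇝_ : Cirq → Cirq → Set
P ⇝ Q = ∀ X → Prov (plug X P) → Prov (plug X Q)

infixr 4 _⊚_
_⊚_ : ∀ {P Q R} → P ⇝ Q → Q ⇝ R → P ⇝ R
(f ⊚ g) X = g X ∘ f X

rule : ∀ {P Q} → Local P Q → P ⇝ Q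
rule ρ X = local X ρ

⇝-cong : ∀ Y {P Q} → P ⇝ Q → plug Y P ⇝ plug Y Q
⇝-cong Y {P} {Q} f X p =
  subst Prov (plug-∘ᶜ X Y Q) (f (X ∘ᶜ Y) (subst Prov (sym (plug-∘ᶜ X Y P)) p))

assoc∨⁻¹ : ∀ A B C → (A ∨ᶜ B) ∨ᶜ C ⇝ A ∨ᶜ (B ∨ᶜ C)
assoc∨⁻¹ A B C = rule (comm∨ C (A ∨ᶜ B)) ⊚ rule (assoc∨ C A B) ⊚ rule (comm∨ B (C ∨ᶜ A))
  ⊚ rule (assoc∨ B C A) ⊚ rule (comm∨ A (B ∨ᶜ C))

⊤⇝-weaken : ∀ B {E} → ⊤ᶜ ⇝ E → ⊤ᶜ ⇝ B ∨ᶜ E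
⊤⇝-weaken B f = rule (domin∨ B) ⊚ ⇝-cong (∨R ∙ B) f

⊤⇝pos∨ : ∀ {E p} → VComp E (neg p) → ⊤ᶜ ⇝ pos p ∨ᶜ E
⊤⇝pos∨ {p = p} self = rule (trivial p) ⊚ rule (comm∨ (pos p) (neg p))
⊤⇝pos∨ {p = p} (∨l {A} {B} h) = ⊤⇝-weaken B (⊤⇝pos∨ h) ⊚ rule (assoc∨ B (pos p) A)
  ⊚ rule (comm∨ A (B ∨ᶜ pos p)) ⊚ rule (assoc∨ A B (pos p)) ⊚ rule (comm∨ (pos p) (A ∨ᶜ B))
⊤⇝pos∨ {p = p} (∨r {A} {B} h) = ⊤⇝-weaken A (⊤⇝pos∨ h) ⊚ rule (assoc∨ A (pos p) B)
  ⊚ ⇝-cong (∨L ∙ B) (rule (comm∨ (pos p) A)) ⊚ assoc∨⁻¹ (pos p) A B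

⊤⇝-disjunct : ∀ {E G p} → VComp E (pos p) → ⊤ᶜ ⇝ pos p ∨ᶜ G → ⊤ᶜ ⇝ E ∨ᶜ G
⊤⇝-disjunct self f = f
⊤⇝-disjunct {G = G} (∨l {A} {B} h) f =
  ⊤⇝-weaken B (⊤⇝-disjunct h f) ⊚ rule (assoc∨ B A G) ⊚ ⇝-cong (∨L ∙ G) (rule (comm∨ A B))
⊤⇝-disjunct {G = G} (∨r {A} {B} h) f = ⊤⇝-weaken A (⊤⇝-disjunct h f) ⊚ rule (assoc∨ A B G)

⊤⇝complementary : ∀ {E p} → VComp E (pos p) → VComp E (neg p) → ⊤ᶜ ⇝ E
⊤⇝complementary (∨l h⁺) (∨l h⁻) = ⊤⇝-weaken _ (⊤⇝complementary h⁺ h⁻) ⊚ rule (comm∨ _ _)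
⊤⇝complementary (∨r h⁺) (∨r h⁻) = ⊤⇝-weaken _ (⊤⇝complementary h⁺ h⁻)
⊤⇝complementary (∨l h⁺) (∨r h⁻) = ⊤⇝-disjunct h⁺ (⊤⇝pos∨ h⁻)
⊤⇝complementary (∨r h⁺) (∨l h⁻) = ⊤⇝-disjunct h⁺ (⊤⇝pos∨ h⁻) ⊚ rule (comm∨ _ _)

_⊒_ : Cirq → Cirq → Set
D ⊒ D′ = Prov D′ → Prov D

SurfRw⇒⊒ : ∀ {R : Cirq → Cirq → Set} → (∀ {P Q} → R P Q → Q ⇝ P) → SurfRw R ⇒ _⊒_
SurfRw⇒⊒ f (rw X {P} {Q} ρ) p =
  subst Prov (sym (splug≡plug X P)) (f ρ (toCtx X) (subst Prov (splug≡plug X Q) p))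

purification-reflects-Prov : PurificationSteps _⊒_
purification-reflects-Prov = record
  { ∼-refl = id
  ; ∼-trans = λ f g → f ∘ g
  ; step1a = SurfRw⇒⊒ λ { (l A) → rule (ident∨ A) ⊚ rule (comm∨ ⊥ᶜ A) ; (r A) → rule (ident∨ A) }
  ; step1b = SurfRw⇒⊒ λ { (l A) → rule (domin∧ A) ⊚ rule (comm∧ ⊥ᶜ A) ; (r A) → rule (domin∧ A) }
  ; step2 = SurfRw⇒⊒ λ { (l A B C) → rule (distr∧ A B C)
                        ; (r A B C) → rule (distr∧ A B C) ⊚ rule (comm∨ C (A ∧ᶜ B)) }
  ; step3 = SurfRw⇒⊒ λ { (l c A B C) → rule (distr⊓ c A B C)
                        ; (r c A B C) → rule (distr⊓ c A B C) ⊚ rule (comm∨ C (⊓ᶜ c A B)) }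
  ; step4 = SurfRw⇒⊒ λ { (tr E p h⁺ h⁻) → ⊤⇝complementary h⁺ h⁻ }
  ; step5a = SurfRw⇒⊒ λ { (l A) → rule (domin∨ A) ⊚ rule (comm∨ ⊤ᶜ A) ; (r A) → rule (domin∨ A) }
  ; step5b = SurfRw⇒⊒ λ { (l A) → rule (ident∧ A) ⊚ rule (comm∧ ⊤ᶜ A) ; (r A) → rule (ident∧ A) }
  ; step6 = λ { (st X a b c A B E F c∉) p →
      subst Prov (sym (splug≡plug X _))
        (quadrilemma (toCtx X) a b c A B E F (subst (¬_ ∘ Occurs (conj c)) (splug≡plug X _) c∉)
          (subst Prov (splug≡plug X _) p)) }
  ; step7a = λ { (st X c E F A) → cleanseL ∙ X c E F A }
  ; step7b = λ { (st X c E F A) → cleanseR ∙ X c E F A }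
  }

tower₅ : ℕ → ℕ
tower₅ n = tower n 5

n+n<5^n : ∀ n → n + n < 5 ^ n
n+n<5^n zero = s≤s z≤n
n+n<5^n (suc n) = begin-strict
  suc n + suc n ≡⟨ cong suc (+-suc n n) ⟩
  2 + (n + n)   <⟨ +-monoʳ-< 2 (n+n<5^n n) ⟩
  2 + 5 ^ n     ≡⟨ +-comm 2 (5 ^ n) ⟩
  5 ^ n + 2     ≤⟨ +-monoʳ-≤ (5 ^ n) (≤-trans (s≤s (s≤s z≤n)) (*-monoʳ-≤ 4 (m^n>0 5 n))) ⟩
  5 ^ n + 4 * 5 ^ n ∎
  where open ≤-Reasoning

n<5^n : ∀ n → n < 5 ^ n
n<5^n n = ≤-<-trans (m≤m+n n n) (n+n<5^n n)

2+n≤5^n : ∀ n → 1 ≤ n → 2 + n ≤ 5 ^ n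
2+n≤5^n (suc k) _ = ≤-trans (s≤s (s≤s (m≤n+m (suc k) k))) (n+n<5^n (suc k))

tower₅-positive : ∀ n → 1 ≤ tower₅ n
tower₅-positive zero = s≤s z≤n
tower₅-positive (suc n) = m^n>0 5 (tower₅ n)

tower₅-mono-≤ : ∀ {m n} → m ≤ n → tower₅ m ≤ tower₅ n
tower₅-mono-≤ {n = n} z≤n = tower₅-positive n
tower₅-mono-≤ (s≤s m≤n) = ^-monoʳ-≤ 5 (tower₅-mono-≤ m≤n)

n<tower₅n : ∀ n → n < tower₅ n
n<tower₅n zero = s≤s z≤n
n<tower₅n (suc n) = ≤-<-trans (n<tower₅n n) (n<5^n (tower₅ n))

tower₅+tower₅≤tower₅ : ∀ {m n k} → m ≤ k → n ≤ k → tower₅ m + tower₅ n ≤ tower₅ (suc k)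
tower₅+tower₅≤tower₅ {k = k} m≤k n≤k = ≤-trans
  (+-mono-≤ (tower₅-mono-≤ m≤k) (tower₅-mono-≤ n≤k)) (<⇒≤ (n+n<5^n (tower₅ k)))

[m+m]+[m+m]≡4*m : ∀ m → (m + m) + (m + m) ≡ 4 * m
[m+m]+[m+m]≡4*m = solve-∀

5^+5^+[5^+5^]≤5^ : ∀ {x₁ x₂ x₃ x₄ k} → x₁ ≤ k → x₂ ≤ k → x₃ ≤ k → x₄ ≤ k →
  (5 ^ x₁ + 5 ^ x₂) + (5 ^ x₃ + 5 ^ x₄) ≤ 5 ^ suc k
5^+5^+[5^+5^]≤5^ {x₁} {x₂} {x₃} {x₄} {k} h₁ h₂ h₃ h₄ = begin
  (5 ^ x₁ + 5 ^ x₂) + (5 ^ x₃ + 5 ^ x₄) ≤⟨ +-mono-≤ (+-mono-≤ (bound h₁) (bound h₂))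
                                                      (+-mono-≤ (bound h₃) (bound h₄)) ⟩
  (y + y) + (y + y)                     ≤⟨ m≤n+m _ y ⟩
  y + ((y + y) + (y + y))               ≡⟨ cong (y +_) ([m+m]+[m+m]≡4*m y) ⟩
  5 * y                                 ∎
  where
  open ≤-Reasoning
  y : ℕ
  y = 5 ^ k
  bound : ∀ {x} → x ≤ k → 5 ^ x ≤ y
  bound = ^-monoʳ-≤ 5

infix 4 _≽_
_≽_ : Cirq → Cirq → Set
D ≽ D′ = rank D′ ≤ rank D

rank-positive : ∀ D → 1 ≤ rank D
rank-positive ⊤ᶜ = s≤s z≤n
rank-positive ⊥ᶜ = s≤s z≤n
rank-positive (pos _) = s≤s z≤n
rank-positive (neg _) = s≤s z≤n
rank-positive (A ∨ᶜ B) = tower₅-positive (rank A + rank B)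
rank-positive (A ∧ᶜ B) = m^n>0 5 (rank A + rank B)
rank-positive (⊓ᶜ _ A B) = ≤-trans (rank-positive A) (m≤m+n _ _)
rank-positive (⊔ᶜ _ A B) = ≤-trans (rank-positive A) (m≤m+n _ _)

rank-plug-mono : ∀ X {P Q} → P ≽ Q → plug X P ≽ plug X Q
rank-plug-mono ∙ h = h
rank-plug-mono (∨L X B) h = tower₅-mono-≤ (+-monoˡ-≤ (rank B) (rank-plug-mono X h))
rank-plug-mono (∨R X A) h = tower₅-mono-≤ (+-monoʳ-≤ (rank A) (rank-plug-mono X h))
rank-plug-mono (∧L X B) h = ^-monoʳ-≤ 5 (+-monoˡ-≤ (rank B) (rank-plug-mono X h))
rank-plug-mono (∧R X A) h = ^-monoʳ-≤ 5 (+-monoʳ-≤ (rank A) (rank-plug-mono X h))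
rank-plug-mono (⊓L n X B) h = +-monoˡ-≤ (rank B) (rank-plug-mono X h)
rank-plug-mono (⊓R n X A) h = +-monoʳ-≤ (rank A) (rank-plug-mono X h)
rank-plug-mono (⊔L n X B) h = +-monoˡ-≤ (rank B) (rank-plug-mono X h)
rank-plug-mono (⊔R n X A) h = +-monoʳ-≤ (rank A) (rank-plug-mono X h)

SurfRw⇒≽ : ∀ {R : Cirq → Cirq → Set} → R ⇒ _≽_ → SurfRw R ⇒ _≽_
SurfRw⇒≽ f (rw X {P} {Q} ρ) rewrite splug≡plug X P | splug≡plug X Q = rank-plug-mono (toCtx X) (f ρ)

suc≤+ : ∀ {m} n → 1 ≤ m → suc n ≤ n + m
suc≤+ {m} n 1≤m = subst (_≤ n + m) (+-comm n 1) (+-monoʳ-≤ n 1≤m)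

R2⇒≽ : R2 ⇒ _≽_
R2⇒≽ (l A B C) = distrib (rank A) (rank B) (rank C) (rank-positive A)
  where
  distrib : ∀ a b c → 1 ≤ a → 5 ^ (tower₅ (a + c) + tower₅ (b + c)) ≤ tower₅ (5 ^ (a + b) + c)
  distrib a b c 1≤a = ≤-trans
    (^-monoʳ-≤ 5 (tower₅+tower₅≤tower₅ (+-monoˡ-≤ c (m≤m+n a b)) (+-monoˡ-≤ c (m≤n+m b a))))
    (tower₅-mono-≤ (+-monoˡ-≤ c (2+n≤5^n (a + b) (≤-trans 1≤a (m≤m+n a b)))))
R2⇒≽ (r A B C) = subst (λ n → rank ((A ∨ᶜ C) ∧ᶜ (B ∨ᶜ C)) ≤ tower₅ n)
  (+-comm (5 ^ (rank A + rank B)) (rank C)) (R2⇒≽ (l A B C))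

R3⇒≽ : R3 ⇒ _≽_
R3⇒≽ (l c A B C) = distrib (rank A) (rank B) (rank C) (rank-positive A) (rank-positive B)
  where
  distrib : ∀ a b c → 1 ≤ a → 1 ≤ b → tower₅ (a + c) + tower₅ (b + c) ≤ tower₅ (a + b + c)
  distrib a (suc b) c 1≤a _ =
    subst (λ n → tower₅ (a + c) + tower₅ (suc b + c) ≤ tower₅ (n + c)) (sym (+-suc a b))
    (tower₅+tower₅≤tower₅ (+-monoˡ-≤ c (m≤m+n a b))
      (+-monoˡ-≤ c (subst (suc b ≤_) (+-comm b a) (suc≤+ b 1≤a))))
R3⇒≽ (r c A B C) = subst (λ n → rank (⊓ᶜ c (A ∨ᶜ C) (B ∨ᶜ C)) ≤ tower₅ n)
  (+-comm (rank A + rank B) (rank C)) (R3⇒≽ (l c A B C))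

Step6⇒≽ : Step6 ⇒ _≽_
Step6⇒≽ (st X a b c A B E F _)
  rewrite splug≡plug X (⊓ᶜ a A B ∧ᶜ ⊓ᶜ b E F) | splug≡plug X (quadPrem a b c A B E F) =
  rank-plug-mono (toCtx X)
    (quadrilemma-bound (rank A) (rank B) (rank E) (rank F) (rank-positive A) (rank-positive B)
      (rank-positive E) (rank-positive F))
  where
  quadrilemma-bound : ∀ a b e f → 1 ≤ a → 1 ≤ b → 1 ≤ e → 1 ≤ f →
    (5 ^ (a + (e + f)) + 5 ^ (b + (e + f))) + (5 ^ ((a + b) + e) + 5 ^ ((a + b) + f))
      ≤ 5 ^ ((a + b) + (e + f))
  quadrilemma-bound (suc a) b e f _ 1≤b 1≤e 1≤f = 5^+5^+[5^+5^]≤5^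
    (+-monoˡ-≤ (e + f) (suc≤+ a 1≤b))
    (+-monoˡ-≤ (e + f) (m≤n+m b a))
    (subst (_≤ a + b + (e + f)) (+-suc (a + b) e) (+-monoʳ-≤ (a + b) (suc≤+ e 1≤f)))
    (subst (_≤ a + b + (e + f)) (+-suc (a + b) f)
      (+-monoʳ-≤ (a + b) (subst (suc f ≤_) (+-comm f e) (suc≤+ f 1≤e))))

purification-decreases-rank : PurificationSteps _≽_
purification-decreases-rank = record
  { ∼-refl = ≤-refl
  ; ∼-trans = λ D≽D′ D′≽D″ → ≤-trans D′≽D″ D≽D′
  ; step1a = SurfRw⇒≽ λ { (l A) → ≤-trans (<⇒≤ (n<tower₅n (rank A))) (tower₅-mono-≤ (m≤n+m (rank A) 1))
                        ; (r A) → ≤-trans (<⇒≤ (n<tower₅n (rank A))) (tower₅-mono-≤ (m≤m+n (rank A) 1)) }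
  ; step1b = SurfRw⇒≽ λ { (l A) → m^n>0 5 (1 + rank A) ; (r A) → m^n>0 5 (rank A + 1) }
  ; step2 = SurfRw⇒≽ R2⇒≽
  ; step3 = SurfRw⇒≽ R3⇒≽
  ; step4 = SurfRw⇒≽ λ { (tr E _ _ _) → rank-positive E }
  ; step5a = SurfRw⇒≽ λ { (l A) → tower₅-positive (1 + rank A) ; (r A) → tower₅-positive (rank A + 1) }
  ; step5b = SurfRw⇒≽ λ { (l A) → ≤-trans (<⇒≤ (n<5^n (rank A))) (^-monoʳ-≤ 5 (m≤n+m (rank A) 1))
                        ; (r A) → ≤-trans (<⇒≤ (n<5^n (rank A))) (^-monoʳ-≤ 5 (m≤m+n (rank A) 1)) }
  ; step6 = Step6⇒≽
  ; step7a = λ { (st X c E F A) → +-monoˡ-≤ (rank A) (rank-plug-mono X (m≤m+n (rank E) (rank F))) }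
  ; step7b = λ { (st X c E F A) → +-monoʳ-≤ (rank A) (rank-plug-mono X (m≤n+m (rank F) (rank E))) }
  }

data Leaf : Cirq → Set where
  lit⁺ : ∀ p → Leaf (pos p)
  lit⁻ : ∀ p → Leaf (neg p)
  choice : ∀ n A B → Leaf (⊔ᶜ n A B)

data Leaf⊤ : Cirq → Set where
  top : Leaf⊤ ⊤ᶜ
  lit⁺ : ∀ p → Leaf⊤ (pos p)
  lit⁻ : ∀ p → Leaf⊤ (neg p)
  choice : ∀ n A B → Leaf⊤ (⊔ᶜ n A B)

data Leaf⊤⊓ : Cirq → Set where
  top : Leaf⊤⊓ ⊤ᶜ
  lit⁺ : ∀ p → Leaf⊤⊓ (pos p)
  lit⁻ : ∀ p → Leaf⊤⊓ (neg p)
  choice : ∀ n A B → Leaf⊤⊓ (⊔ᶜ n A B)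
  meet : ∀ n A B → Leaf⊤⊓ (⊓ᶜ n A B)

data OrOf (L : Cirq → Set) : Cirq → Set where
  or : ∀ {A B} → OrOf L A → OrOf L B → OrOf L (A ∨ᶜ B)
  leaf : ∀ {D} → L D → OrOf L D

data AndOf (K : Cirq → Set) : Cirq → Set where
  and : ∀ {A B} → AndOf K A → AndOf K B → AndOf K (A ∧ᶜ B)
  leaf : ∀ {D} → K D → AndOf K D

record Atomic (L : Cirq → Set) : Set where
  field
    not-∨ : ∀ {A B} → ¬ L (A ∨ᶜ B)
    not-∧ : ∀ {A B} → ¬ L (A ∧ᶜ B)
open Atomic

Leaf-atomic : Atomic Leaf
Leaf-atomic = record { not-∨ = λ () ; not-∧ = λ () }

Leaf⊤-atomic : Atomic Leaf⊤
Leaf⊤-atomic = record { not-∨ = λ () ; not-∧ = λ () }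

Leaf⊤⊓-atomic : Atomic Leaf⊤⊓
Leaf⊤⊓-atomic = record { not-∨ = λ () ; not-∧ = λ () }

module _ {L : Cirq → Set} (atomic : Atomic L) where

  OrOf-replace : ∀ Y {P Q} → OrOf L (splug Y P) → (OrOf L P → OrOf L Q) → OrOf L (splug Y Q)
  OrOf-replace ∙ c f = f c
  OrOf-replace (∨L Y B) (or c d) f = or (OrOf-replace Y c f) d
  OrOf-replace (∨R Y A) (or c d) f = or c (OrOf-replace Y d f)
  OrOf-replace (∨L Y B) (leaf x) f = ⊥-elim (not-∨ atomic x)
  OrOf-replace (∨R Y A) (leaf x) f = ⊥-elim (not-∨ atomic x)
  OrOf-replace (∧L Y B) (leaf x) f = ⊥-elim (not-∧ atomic x)
  OrOf-replace (∧R Y A) (leaf x) f = ⊥-elim (not-∧ atomic x)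

  OrOf-sub : ∀ Y {P} → OrOf L (splug Y P) → OrOf L P
  OrOf-sub ∙ c = c
  OrOf-sub (∨L Y B) (or c d) = OrOf-sub Y c
  OrOf-sub (∨R Y A) (or c d) = OrOf-sub Y d
  OrOf-sub (∨L Y B) (leaf x) = ⊥-elim (not-∨ atomic x)
  OrOf-sub (∨R Y A) (leaf x) = ⊥-elim (not-∨ atomic x)
  OrOf-sub (∧L Y B) (leaf x) = ⊥-elim (not-∧ atomic x)
  OrOf-sub (∧R Y A) (leaf x) = ⊥-elim (not-∧ atomic x)

  OrOf-VComp : ∀ Y {P E} → OrOf L (splug Y P) → VComp P E → VComp (splug Y P) E
  OrOf-VComp ∙ c v = v
  OrOf-VComp (∨L Y B) (or c d) v = ∨l (OrOf-VComp Y c v)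
  OrOf-VComp (∨R Y A) (or c d) v = ∨r (OrOf-VComp Y d v)
  OrOf-VComp (∨L Y B) (leaf x) v = ⊥-elim (not-∨ atomic x)
  OrOf-VComp (∨R Y A) (leaf x) v = ⊥-elim (not-∨ atomic x)
  OrOf-VComp (∧L Y B) (leaf x) v = ⊥-elim (not-∧ atomic x)
  OrOf-VComp (∧R Y A) (leaf x) v = ⊥-elim (not-∧ atomic x)

  OrOf-no-∧ : ∀ Y {A B} → ¬ OrOf L (splug Y (A ∧ᶜ B))
  OrOf-no-∧ Y c with OrOf-sub Y c
  ... | leaf x = not-∧ atomic x

AndOf-replace : ∀ {K} X {P Q} → AndOf K (splug X P) → (AndOf K P → AndOf K Q) →
  (∀ Y → K (splug Y P) → K (splug Y Q)) → AndOf K (splug X Q)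
AndOf-replace ∙ a f g = f a
AndOf-replace (∧L X B) (and a b) f g = and (AndOf-replace X a f g) b
AndOf-replace (∧R X A) (and a b) f g = and a (AndOf-replace X b f g)
AndOf-replace X (leaf k) f g = leaf (g X k)

AndOf-sub : ∀ {K} X {P} → AndOf K (splug X P) → AndOf K P ⊎ Σ SCtx (λ Y → K (splug Y P))
AndOf-sub ∙ a = inj₁ a
AndOf-sub (∧L X B) (and a b) = AndOf-sub X a
AndOf-sub (∧R X A) (and a b) = AndOf-sub X b
AndOf-sub X (leaf k) = inj₂ (X , k)

AndOf-atom : ∀ {K A} → AndOf K A → ¬ IsAnd A → K A
AndOf-atom (and _ _) ¬and = ⊥-elim (¬and (_ , _ , refl))
AndOf-atom (leaf k) ¬and = k

IsMeet-sub : ∀ Y {P} → IsMeet (splug Y P) → IsMeet P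
IsMeet-sub ∙ m = m

IsMeet? : ∀ D → Dec (IsMeet D)
IsMeet? (⊓ᶜ n A B) = yes (n , A , B , refl)
IsMeet? ⊤ᶜ = no λ ()
IsMeet? ⊥ᶜ = no λ ()
IsMeet? (pos _) = no λ ()
IsMeet? (neg _) = no λ ()
IsMeet? (_ ∨ᶜ _) = no λ ()
IsMeet? (_ ∧ᶜ _) = no λ ()
IsMeet? (⊔ᶜ _ _ _) = no λ ()

SurfNormal : (Cirq → Cirq → Set) → Cirq → Set
SurfNormal R D = ∀ D′ → ¬ SurfRw R D D′

module _ {R : Cirq → Cirq → Set} where

  SurfNormal-∨ˡ : ∀ {A B} → SurfNormal R (A ∨ᶜ B) → SurfNormal R A
  SurfNormal-∨ˡ {B = B} h _ (rw X ρ) = h _ (rw (∨L X B) ρ)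

  SurfNormal-∨ʳ : ∀ {A B} → SurfNormal R (A ∨ᶜ B) → SurfNormal R B
  SurfNormal-∨ʳ {A = A} h _ (rw X ρ) = h _ (rw (∨R X A) ρ)

  SurfNormal-∧ˡ : ∀ {A B} → SurfNormal R (A ∧ᶜ B) → SurfNormal R A
  SurfNormal-∧ˡ {B = B} h _ (rw X ρ) = h _ (rw (∧L X B) ρ)

  SurfNormal-∧ʳ : ∀ {A B} → SurfNormal R (A ∧ᶜ B) → SurfNormal R B
  SurfNormal-∧ʳ {A = A} h _ (rw X ρ) = h _ (rw (∧R X A) ρ)

  SurfRw-irreflexive : (∀ {P} → ¬ R P P) → ∀ {D} → ¬ SurfRw R D D
  SurfRw-irreflexive R-irrefl s = go s refl
    where
    go : ∀ {D D′} → SurfRw R D D′ → D ≡ D′ → ⊥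
    go (rw X ρ) eq with splug-injective X eq
    ... | refl = R-irrefl ρ

infix 4 _>ˢ_
_>ˢ_ : Cirq → Cirq → Set
D >ˢ D′ = size D′ < size D

SurfRw⇒>ˢ : ∀ {R : Cirq → Cirq → Set} → R ⇒ _>ˢ_ → SurfRw R ⇒ _>ˢ_
SurfRw⇒>ˢ f (rw X ρ) = splug-size< X (f ρ)

⊥-Free : Cirq → Set
⊥-Free ⊥ᶜ = ⊥
⊥-Free (A ∨ᶜ B) = ⊥-Free A × ⊥-Free B
⊥-Free (A ∧ᶜ B) = ⊥-Free A × ⊥-Free B
⊥-Free _ = ⊤

ClashFree : Cirq → Set
ClashFree D = ∀ p → ¬ (VComp D (pos p) × VComp D (neg p))

Conjunct₃ Conjunct₄ Conjunct₅ : Cirq → Set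
Conjunct₃ D = IsMeet D ⊎ OrOf Leaf⊤ D
Conjunct₄ D = IsMeet D ⊎ (OrOf Leaf⊤ D × ClashFree D)
Conjunct₅ D = IsMeet D ⊎ (OrOf Leaf D × ClashFree D)

Shape₁ Shape₂ Shape₃ Shape₄ Shape₅ : Cirq → Set
Shape₁ D = D ≡ ⊥ᶜ ⊎ ⊥-Free D
Shape₂ D = D ≡ ⊥ᶜ ⊎ AndOf (OrOf Leaf⊤⊓) D
Shape₃ D = D ≡ ⊥ᶜ ⊎ AndOf Conjunct₃ D
Shape₄ D = D ≡ ⊥ᶜ ⊎ AndOf Conjunct₄ D
Shape₅ D = D ≡ ⊥ᶜ ⊎ D ≡ ⊤ᶜ ⊎ AndOf Conjunct₅ D

stage1-exit : ∀ D → SurfNormal R1a D → SurfNormal R1b D → Shape₁ D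
stage1-exit (A ∨ᶜ B) h₁ h₂
  with stage1-exit A (SurfNormal-∨ˡ h₁) (SurfNormal-∨ˡ h₂)
     | stage1-exit B (SurfNormal-∨ʳ h₁) (SurfNormal-∨ʳ h₂)
... | inj₁ refl | _ = ⊥-elim (h₁ _ (rw ∙ (l B)))
... | inj₂ _ | inj₁ refl = ⊥-elim (h₁ _ (rw ∙ (r A)))
... | inj₂ a | inj₂ b = inj₂ (a , b)
stage1-exit (A ∧ᶜ B) h₁ h₂
  with stage1-exit A (SurfNormal-∧ˡ h₁) (SurfNormal-∧ˡ h₂)
     | stage1-exit B (SurfNormal-∧ʳ h₁) (SurfNormal-∧ʳ h₂)
... | inj₁ refl | _ = ⊥-elim (h₂ _ (rw ∙ (l B)))
... | inj₂ _ | inj₁ refl = ⊥-elim (h₂ _ (rw ∙ (r A)))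
... | inj₂ a | inj₂ b = inj₂ (a , b)
stage1-exit ⊥ᶜ _ _ = inj₁ refl
stage1-exit ⊤ᶜ _ _ = inj₂ tt
stage1-exit (pos _) _ _ = inj₂ tt
stage1-exit (neg _) _ _ = inj₂ tt
stage1-exit (⊓ᶜ _ _ _) _ _ = inj₂ tt
stage1-exit (⊔ᶜ _ _ _) _ _ = inj₂ tt

⊥-Free-replace : ∀ X {P Q} → ⊥-Free (splug X P) → (⊥-Free P → ⊥-Free Q) → ⊥-Free (splug X Q)
⊥-Free-replace ∙ n f = f n
⊥-Free-replace (∨L X B) (n , m) f = ⊥-Free-replace X n f , m
⊥-Free-replace (∨R X A) (m , n) f = m , ⊥-Free-replace X n f
⊥-Free-replace (∧L X B) (n , m) f = ⊥-Free-replace X n f , m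
⊥-Free-replace (∧R X A) (m , n) f = m , ⊥-Free-replace X n f

R2-preserves-Shape₁ : ∀ {D D′} → SurfRw R2 D D′ → Shape₁ D → Shape₁ D′
R2-preserves-Shape₁ (rw X (l A B C)) (inj₁ e) with () ← splug≡⊥ᶜ X e
R2-preserves-Shape₁ (rw X (r A B C)) (inj₁ e) with () ← splug≡⊥ᶜ X e
R2-preserves-Shape₁ (rw X (l A B C)) (inj₂ n) =
  inj₂ (⊥-Free-replace X n λ { ((a , b) , c) → (a , c) , (b , c) })
R2-preserves-Shape₁ (rw X (r A B C)) (inj₂ n) =
  inj₂ (⊥-Free-replace X n λ { (c , (a , b)) → (a , c) , (b , c) })

⊥-Free-R2-normal⇒AndOf : ∀ D → ⊥-Free D → SurfNormal R2 D → AndOf (OrOf Leaf⊤⊓) D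
⊥-Free-R2-normal⇒AndOf (A ∧ᶜ B) (a , b) h =
  and (⊥-Free-R2-normal⇒AndOf A a (SurfNormal-∧ˡ h)) (⊥-Free-R2-normal⇒AndOf B b (SurfNormal-∧ʳ h))
⊥-Free-R2-normal⇒AndOf (A ∨ᶜ B) (a , b) h = leaf (or
  (AndOf-atom (⊥-Free-R2-normal⇒AndOf A a (SurfNormal-∨ˡ h)) λ { (_ , _ , refl) → h _ (rw ∙ (l _ _ B)) })
  (AndOf-atom (⊥-Free-R2-normal⇒AndOf B b (SurfNormal-∨ʳ h)) λ { (_ , _ , refl) → h _ (rw ∙ (r _ _ A)) }))
⊥-Free-R2-normal⇒AndOf ⊤ᶜ _ _ = leaf (leaf top)
⊥-Free-R2-normal⇒AndOf (pos p) _ _ = leaf (leaf (lit⁺ p))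
⊥-Free-R2-normal⇒AndOf (neg p) _ _ = leaf (leaf (lit⁻ p))
⊥-Free-R2-normal⇒AndOf (⊓ᶜ n A B) _ _ = leaf (leaf (meet n A B))
⊥-Free-R2-normal⇒AndOf (⊔ᶜ n A B) _ _ = leaf (leaf (choice n A B))

stage2-exit : ∀ D → Shape₁ D → SurfNormal R2 D → Shape₂ D
stage2-exit D (inj₁ e) h = inj₁ e
stage2-exit D (inj₂ n) h = inj₂ (⊥-Free-R2-normal⇒AndOf D n h)

R3-preserves-Shape₂ : ∀ {D D′} → SurfRw R3 D D′ → Shape₂ D → Shape₂ D′
R3-preserves-Shape₂ (rw X (l c A B C)) (inj₁ e) with () ← splug≡⊥ᶜ X e
R3-preserves-Shape₂ (rw X (r c A B C)) (inj₁ e) with () ← splug≡⊥ᶜ X e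
R3-preserves-Shape₂ (rw X (l c A B C)) (inj₂ a) = inj₂ (AndOf-replace X a (λ _ → leaf (leaf (meet _ _ _)))
  λ Y k → OrOf-replace Leaf⊤⊓-atomic Y k λ _ → leaf (meet _ _ _))
R3-preserves-Shape₂ (rw X (r c A B C)) (inj₂ a) = inj₂ (AndOf-replace X a (λ _ → leaf (leaf (meet _ _ _)))
  λ Y k → OrOf-replace Leaf⊤⊓-atomic Y k λ _ → leaf (meet _ _ _))

OrOf-R3-normal⇒Leaf⊤ : ∀ {D} → OrOf Leaf⊤⊓ D → ¬ IsMeet D → SurfNormal R3 D → OrOf Leaf⊤ D
OrOf-R3-normal⇒Leaf⊤ (or {A} {B} a b) _ h =
  or (OrOf-R3-normal⇒Leaf⊤ a (λ { (_ , _ , _ , refl) → h _ (rw ∙ (l _ _ _ B)) }) (SurfNormal-∨ˡ h))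
     (OrOf-R3-normal⇒Leaf⊤ b (λ { (_ , _ , _ , refl) → h _ (rw ∙ (r _ _ _ A)) }) (SurfNormal-∨ʳ h))
OrOf-R3-normal⇒Leaf⊤ (leaf top) _ _ = leaf top
OrOf-R3-normal⇒Leaf⊤ (leaf (lit⁺ p)) _ _ = leaf (lit⁺ p)
OrOf-R3-normal⇒Leaf⊤ (leaf (lit⁻ p)) _ _ = leaf (lit⁻ p)
OrOf-R3-normal⇒Leaf⊤ (leaf (choice n A B)) _ _ = leaf (choice n A B)
OrOf-R3-normal⇒Leaf⊤ (leaf (meet n A B)) ¬meet _ = ⊥-elim (¬meet (n , A , B , refl))

AndOf-R3-normal⇒Conjunct₃ : ∀ {D} → AndOf (OrOf Leaf⊤⊓) D → SurfNormal R3 D → AndOf Conjunct₃ D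
AndOf-R3-normal⇒Conjunct₃ (and a b) h =
  and (AndOf-R3-normal⇒Conjunct₃ a (SurfNormal-∧ˡ h)) (AndOf-R3-normal⇒Conjunct₃ b (SurfNormal-∧ʳ h))
AndOf-R3-normal⇒Conjunct₃ {D} (leaf c) h with IsMeet? D
... | yes m = leaf (inj₁ m)
... | no ¬m = leaf (inj₂ (OrOf-R3-normal⇒Leaf⊤ c ¬m h))

stage3-exit : ∀ D → Shape₂ D → SurfNormal R3 D → Shape₃ D
stage3-exit D (inj₁ e) h = inj₁ e
stage3-exit D (inj₂ a) h = inj₂ (AndOf-R3-normal⇒Conjunct₃ a h)

Conjunct₃-replace : ∀ Y {P Q} → Conjunct₃ (splug Y P) → (OrOf Leaf⊤ P → OrOf Leaf⊤ Q) → Conjunct₃ Q →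
  Conjunct₃ (splug Y Q)
Conjunct₃-replace ∙ _ _ k = k
Conjunct₃-replace Y (inj₂ c) f _ = inj₂ (OrOf-replace Leaf⊤-atomic Y c f)

R4-preserves-Shape₃ : ∀ {D D′} → SurfRw R4 D D′ → Shape₃ D → Shape₃ D′
R4-preserves-Shape₃ (rw X (tr E p v⁺ v⁻)) (inj₁ e) with refl ← splug≡⊥ᶜ X e with () ← v⁺
R4-preserves-Shape₃ (rw X (tr E p v⁺ v⁻)) (inj₂ a) = inj₂ (AndOf-replace X a (λ _ → leaf (inj₂ (leaf top)))
  λ Y k → Conjunct₃-replace Y k (λ _ → leaf top) (inj₂ (leaf top)))

AndOf-R4-normal⇒Conjunct₄ : ∀ {D} → AndOf Conjunct₃ D → SurfNormal R4 D → AndOf Conjunct₄ D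
AndOf-R4-normal⇒Conjunct₄ (and a b) h =
  and (AndOf-R4-normal⇒Conjunct₄ a (SurfNormal-∧ˡ h)) (AndOf-R4-normal⇒Conjunct₄ b (SurfNormal-∧ʳ h))
AndOf-R4-normal⇒Conjunct₄ (leaf (inj₁ m)) h = leaf (inj₁ m)
AndOf-R4-normal⇒Conjunct₄ (leaf (inj₂ c)) h = leaf (inj₂ (c , λ p (v⁺ , v⁻) → h _ (rw ∙ (tr _ p v⁺ v⁻))))

stage4-exit : ∀ D → Shape₃ D → SurfNormal R4 D → Shape₄ D
stage4-exit D (inj₁ e) h = inj₁ e
stage4-exit D (inj₂ a) h = inj₂ (AndOf-R4-normal⇒Conjunct₄ a h)

VComp-replace⊤ : ∀ Y {P E} → Leaf E → VComp (splug Y ⊤ᶜ) E → VComp (splug Y P) E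
VComp-replace⊤ ∙ () self
VComp-replace⊤ (∧L Y B) () self
VComp-replace⊤ (∧R Y A) () self
VComp-replace⊤ (∨L Y B) e (∨l v) = ∨l (VComp-replace⊤ Y e v)
VComp-replace⊤ (∨L Y B) e (∨r v) = ∨r v
VComp-replace⊤ (∨R Y A) e (∨l v) = ∨l v
VComp-replace⊤ (∨R Y A) e (∨r v) = ∨r (VComp-replace⊤ Y e v)

ClashFree-replace⊤ : ∀ Y {P} → ClashFree (splug Y P) → ClashFree (splug Y ⊤ᶜ)
ClashFree-replace⊤ Y cf p (v⁺ , v⁻) = cf p (VComp-replace⊤ Y (lit⁺ p) v⁺ , VComp-replace⊤ Y (lit⁻ p) v⁻)

Conjunct₄-replace⊤ : ∀ Y {P} → Conjunct₄ (splug Y P) → Conjunct₄ (splug Y ⊤ᶜ)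
Conjunct₄-replace⊤ ∙ _ = inj₂ (leaf top , λ _ ())
Conjunct₄-replace⊤ Y (inj₂ (c , cf)) =
  inj₂ (OrOf-replace Leaf⊤-atomic Y c (λ _ → leaf top) , ClashFree-replace⊤ Y cf)

R5a-preserves-Shape₄ : ∀ {D D′} → SurfRw R5a D D′ → Shape₄ D → Shape₄ D′
R5a-preserves-Shape₄ (rw X (l A)) (inj₁ e) with () ← splug≡⊥ᶜ X e
R5a-preserves-Shape₄ (rw X (r A)) (inj₁ e) with () ← splug≡⊥ᶜ X e
R5a-preserves-Shape₄ (rw X (l A)) (inj₂ a) =
  inj₂ (AndOf-replace X a (λ _ → leaf (inj₂ (leaf top , λ _ ()))) λ Y → Conjunct₄-replace⊤ Y)
R5a-preserves-Shape₄ (rw X (r A)) (inj₂ a) =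
  inj₂ (AndOf-replace X a (λ _ → leaf (inj₂ (leaf top , λ _ ()))) λ Y → Conjunct₄-replace⊤ Y)

Conjunct-no-∧ : ∀ {L N : Cirq → Set} → Atomic L → ∀ Y {A B} →
  ¬ (IsMeet (splug Y (A ∧ᶜ B)) ⊎ (OrOf L (splug Y (A ∧ᶜ B)) × N (splug Y (A ∧ᶜ B))))
Conjunct-no-∧ atomic Y (inj₁ m) with () ← IsMeet-sub Y m
Conjunct-no-∧ atomic Y (inj₂ (c , _)) = OrOf-no-∧ atomic Y c

Conjunct₄-no-∧ : ∀ Y {A B} → ¬ Conjunct₄ (splug Y (A ∧ᶜ B))
Conjunct₄-no-∧ = Conjunct-no-∧ {N = ClashFree} Leaf⊤-atomic

R5b-preserves-Shape₄ : ∀ {D D′} → SurfRw R5b D D′ → Shape₄ D → Shape₄ D′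
R5b-preserves-Shape₄ (rw X (l A)) (inj₁ e) with () ← splug≡⊥ᶜ X e
R5b-preserves-Shape₄ (rw X (r A)) (inj₁ e) with () ← splug≡⊥ᶜ X e
R5b-preserves-Shape₄ (rw X (l A)) (inj₂ a) =
  inj₂ (AndOf-replace X a (λ { (and _ b) → b ; (leaf k) → ⊥-elim (Conjunct₄-no-∧ ∙ k) })
    λ Y k → ⊥-elim (Conjunct₄-no-∧ Y k))
R5b-preserves-Shape₄ (rw X (r A)) (inj₂ a) =
  inj₂ (AndOf-replace X a (λ { (and b _) → b ; (leaf k) → ⊥-elim (Conjunct₄-no-∧ ∙ k) })
    λ Y k → ⊥-elim (Conjunct₄-no-∧ Y k))

OrOf-R5a-normal⇒Leaf : ∀ {D} → OrOf Leaf⊤ D → SurfNormal R5a D → D ≡ ⊤ᶜ ⊎ OrOf Leaf D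
OrOf-R5a-normal⇒Leaf (or {A} {B} a b) h
  with OrOf-R5a-normal⇒Leaf a (SurfNormal-∨ˡ h) | OrOf-R5a-normal⇒Leaf b (SurfNormal-∨ʳ h)
... | inj₁ refl | _ = ⊥-elim (h _ (rw ∙ (l B)))
... | inj₂ _ | inj₁ refl = ⊥-elim (h _ (rw ∙ (r A)))
... | inj₂ a′ | inj₂ b′ = inj₂ (or a′ b′)
OrOf-R5a-normal⇒Leaf (leaf top) _ = inj₁ refl
OrOf-R5a-normal⇒Leaf (leaf (lit⁺ p)) _ = inj₂ (leaf (lit⁺ p))
OrOf-R5a-normal⇒Leaf (leaf (lit⁻ p)) _ = inj₂ (leaf (lit⁻ p))
OrOf-R5a-normal⇒Leaf (leaf (choice n A B)) _ = inj₂ (leaf (choice n A B))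

AndOf-R5-normal⇒Conjunct₅ : ∀ {D} → AndOf Conjunct₄ D → SurfNormal R5a D → SurfNormal R5b D →
  D ≡ ⊤ᶜ ⊎ AndOf Conjunct₅ D
AndOf-R5-normal⇒Conjunct₅ (and {A} {B} a b) h₁ h₂
  with AndOf-R5-normal⇒Conjunct₅ a (SurfNormal-∧ˡ h₁) (SurfNormal-∧ˡ h₂)
     | AndOf-R5-normal⇒Conjunct₅ b (SurfNormal-∧ʳ h₁) (SurfNormal-∧ʳ h₂)
... | inj₁ refl | _ = ⊥-elim (h₂ _ (rw ∙ (l B)))
... | inj₂ _ | inj₁ refl = ⊥-elim (h₂ _ (rw ∙ (r A)))
... | inj₂ a′ | inj₂ b′ = inj₂ (and a′ b′)
AndOf-R5-normal⇒Conjunct₅ (leaf (inj₁ m)) _ _ = inj₂ (leaf (inj₁ m))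
AndOf-R5-normal⇒Conjunct₅ (leaf (inj₂ (c , cf))) h₁ _ with OrOf-R5a-normal⇒Leaf c h₁
... | inj₁ e = inj₁ e
... | inj₂ c′ = inj₂ (leaf (inj₂ (c′ , cf)))

stage5-exit : ∀ D → Shape₄ D → SurfNormal R5a D → SurfNormal R5b D → Shape₅ D
stage5-exit D (inj₁ e) _ _ = inj₁ e
stage5-exit D (inj₂ a) h₁ h₂ = inj₂ (AndOf-R5-normal⇒Conjunct₅ a h₁ h₂)

Step6-preserves-Shape₅ : ∀ {D D′} → Step6 D D′ → Shape₅ D → Shape₅ D′
Step6-preserves-Shape₅ (st X a b c A B E F _) (inj₁ e) with () ← splug≡⊥ᶜ X e
Step6-preserves-Shape₅ (st X a b c A B E F _) (inj₂ (inj₁ e)) with () ← splug≡⊤ᶜ X e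
Step6-preserves-Shape₅ (st X a b c A B E F _) (inj₂ (inj₂ as)) =
  inj₂ (inj₂ (AndOf-replace X as (λ _ → leaf (inj₁ (c , _ , _ , refl)))
    λ Y k → ⊥-elim (Conjunct-no-∧ {N = ClashFree} Leaf-atomic Y k)))

Step6-irreflexive : ∀ {D} → ¬ Step6 D D
Step6-irreflexive s = go s refl
  where
  go : ∀ {D D′} → Step6 D D′ → D ≢ D′
  go (st X a b c A B E F _) eq with () ← splug-injective X eq

NoSurface⊓∧⊓ : Cirq → Set
NoSurface⊓∧⊓ D = ∀ X a b A B E F → D ≢ splug X (⊓ᶜ a A B ∧ᶜ ⊓ᶜ b E F)

Step6-normal⇒NoSurface⊓∧⊓ : ∀ {D} → (∀ D′ → ¬ Step6 D D′) → NoSurface⊓∧⊓ D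
Step6-normal⇒NoSurface⊓∧⊓ {D} h X a b A B E F refl =
  h _ (st X a b (conjBound D) A B E F (conjBound-fresh D))

IsAnd? : ∀ D → Dec (IsAnd D)
IsAnd? (A ∧ᶜ B) = yes (A , B , refl)
IsAnd? ⊤ᶜ = no λ ()
IsAnd? ⊥ᶜ = no λ ()
IsAnd? (pos _) = no λ ()
IsAnd? (neg _) = no λ ()
IsAnd? (_ ∨ᶜ _) = no λ ()
IsAnd? (⊓ᶜ _ _ _) = no λ ()
IsAnd? (⊔ᶜ _ _ _) = no λ ()

NoSurface⊓∧⊓-∧ˡ : ∀ {A B} → NoSurface⊓∧⊓ (A ∧ᶜ B) → NoSurface⊓∧⊓ A
NoSurface⊓∧⊓-∧ˡ {B = B} h X a b A₁ A₂ B₁ B₂ eq = h (∧L X B) a b A₁ A₂ B₁ B₂ (cong (_∧ᶜ B) eq)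

NoSurface⊓∧⊓-∧ʳ : ∀ {A B} → NoSurface⊓∧⊓ (A ∧ᶜ B) → NoSurface⊓∧⊓ B
NoSurface⊓∧⊓-∧ʳ {A} h X a b A₁ A₂ B₁ B₂ eq = h (∧R X A) a b A₁ A₂ B₁ B₂ (cong (A ∧ᶜ_) eq)

non-meet-conjunct : ∀ D → NoSurface⊓∧⊓ D → IsAnd D → ∃[ F ] (ConjLeaf D F × ¬ IsMeet F)
non-meet-conjunct (A ∧ᶜ B) h _ with IsAnd? A | IsMeet? A | IsAnd? B | IsMeet? B
... | yes A∧ | _ | _ | _ with F , leafF , ¬meet ← non-meet-conjunct A (NoSurface⊓∧⊓-∧ˡ h) A∧ =
  F , ∧l leafF , ¬meet
... | no ¬A∧ | no ¬meet | _ | _ = A , ∧l (leaf ¬A∧) , ¬meet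
... | _ | _ | yes B∧ | _ with F , leafF , ¬meet ← non-meet-conjunct B (NoSurface⊓∧⊓-∧ʳ h) B∧ =
  F , ∧r leafF , ¬meet
... | _ | _ | no ¬B∧ | no ¬meet = B , ∧r (leaf ¬B∧) , ¬meet
... | no _ | yes (a , A₁ , A₂ , refl) | no _ | yes (b , B₁ , B₂ , refl) = ⊥-elim (h ∙ a b A₁ A₂ B₁ B₂ refl)

AndOf-Surf : ∀ {D E} → AndOf Conjunct₅ D → Surf D E → AndOf Conjunct₅ E ⊎ Conjunct₅ E
AndOf-Surf a (X , refl) with AndOf-sub X a
... | inj₁ a′ = inj₁ a′
... | inj₂ (Y , inj₁ m) = inj₂ (inj₁ (IsMeet-sub Y m))
... | inj₂ (Y , inj₂ (c , cf)) = inj₂ (inj₂ (OrOf-sub Leaf-atomic Y c ,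
  λ p (v⁺ , v⁻) → cf p (OrOf-VComp Leaf-atomic Y c v⁺ , OrOf-VComp Leaf-atomic Y c v⁻)))

Surf-Conjunct₅ : ∀ {D E} → AndOf Conjunct₅ D → Surf D E → ¬ IsAnd E → Conjunct₅ E
Surf-Conjunct₅ a s ¬∧ with AndOf-Surf a s
... | inj₁ a′ = AndOf-atom a′ ¬∧
... | inj₂ k = k

Conjunct₅-∨ : ∀ {A B} → Conjunct₅ (A ∨ᶜ B) → OrOf Leaf A × OrOf Leaf B
Conjunct₅-∨ (inj₂ (or a b , _)) = a , b

Pure-AndOf : ∀ D → AndOf Conjunct₅ D → ¬ IsMeet D → NoSurface⊓∧⊓ D → Pure D
Pure-AndOf D as ¬meet h = record
  { p1 = λ _ s → ¬Conjunct₅⊥ᶜ (Surf-Conjunct₅ as s λ ())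
  ; p2 = λ _ _ s _ _ → no-∧ (Conjunct₅-∨ (Surf-Conjunct₅ as s λ ()))
  ; p3 = λ _ _ s _ _ _ → no-⊓ (Conjunct₅-∨ (Surf-Conjunct₅ as s λ ()))
  ; p4 = λ _ p s → clash-free (AndOf-Surf as s) p
  ; p5 = λ _ s → ¬Conjunct₅⊤ᶜ (Surf-Conjunct₅ as s λ ())
  ; p6 = non-meet-conjunct D h
  ; p7 = λ n A B e → ⊥-elim (¬meet (n , A , B , e))
  }
  where
  ¬Conjunct₅⊥ᶜ : ¬ Conjunct₅ ⊥ᶜ
  ¬Conjunct₅⊥ᶜ (inj₂ (leaf () , _))
  ¬Conjunct₅⊤ᶜ : ¬ Conjunct₅ ⊤ᶜ
  ¬Conjunct₅⊤ᶜ (inj₂ (leaf () , _))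
  no-∧ : ∀ {X Y E F} → OrOf Leaf X × OrOf Leaf Y → ¬ (Surf X (E ∧ᶜ F) ⊎ Surf Y (E ∧ᶜ F))
  no-∧ (x , _) (inj₁ (W , refl)) = OrOf-no-∧ Leaf-atomic W x
  no-∧ (_ , y) (inj₂ (W , refl)) = OrOf-no-∧ Leaf-atomic W y
  no-⊓ : ∀ {X Y n E F} → OrOf Leaf X × OrOf Leaf Y → ¬ (Surf X (⊓ᶜ n E F) ⊎ Surf Y (⊓ᶜ n E F))
  no-⊓ (x , _) (inj₁ (W , refl)) with leaf () ← OrOf-sub Leaf-atomic W x
  no-⊓ (_ , y) (inj₂ (W , refl)) with leaf () ← OrOf-sub Leaf-atomic W y
  clash-free : ∀ {E} → AndOf Conjunct₅ E ⊎ Conjunct₅ E → ClashFree E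
  clash-free (inj₁ (and _ _)) p (() , _)
  clash-free (inj₁ (leaf k)) = clash-free (inj₂ k)
  clash-free (inj₂ (inj₁ (_ , _ , _ , refl))) p (() , _)
  clash-free (inj₂ (inj₂ (_ , cf))) = cf

module _ {D : Cirq} (¬∨ : ∀ {A B} → D ≢ A ∨ᶜ B) (¬∧ : ∀ {A B} → D ≢ A ∧ᶜ B) where

  Surf-nonbinary : ∀ {E} → Surf D E → E ≡ D
  Surf-nonbinary (∙ , e) = sym e
  Surf-nonbinary (∨L _ _ , e) = ⊥-elim (¬∨ e)
  Surf-nonbinary (∨R _ _ , e) = ⊥-elim (¬∨ e)
  Surf-nonbinary (∧L _ _ , e) = ⊥-elim (¬∧ e)
  Surf-nonbinary (∧R _ _ , e) = ⊥-elim (¬∧ e)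

  ClashFree-nonbinary : ClashFree D
  ClashFree-nonbinary p (v⁺ , v⁻) = go v⁺ v⁻ refl
    where
    go : ∀ {E} → VComp E (pos p) → VComp E (neg p) → E ≢ D
    go self () _
    go (∨l _) _ e = ¬∨ (sym e)
    go (∨r _) _ e = ¬∨ (sym e)

  Pure-nonbinary : (∀ n A B → D ≡ ⊓ᶜ n A B → ¬ Occurs (conj n) A × ¬ Occurs (conj n) B) → Pure D
  Pure-nonbinary fresh-root = record
    { p1 = λ D≢⊥ s → D≢⊥ (sym (Surf-nonbinary s))
    ; p2 = λ _ _ s _ _ _ → ¬∨ (sym (Surf-nonbinary s))
    ; p3 = λ _ _ s _ _ _ _ → ¬∨ (sym (Surf-nonbinary s))
    ; p4 = λ _ p s → subst ClashFree (sym (Surf-nonbinary s)) ClashFree-nonbinary p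
    ; p5 = λ D≢⊤ s → D≢⊤ (sym (Surf-nonbinary s))
    ; p6 = λ (_ , _ , e) → ⊥-elim (¬∧ e)
    ; p7 = fresh-root
    }

Occurs⇒plug : ∀ {n A} → Occurs (conj n) A → ∃[ X ] ∃[ E ] ∃[ F ] (A ≡ plug X (⊓ᶜ n E F))
Occurs⇒plug here⊓ = ∙ , _ , _ , refl
Occurs⇒plug (∨l {B = B} o) with X , E , F , refl ← Occurs⇒plug o = ∨L X B , E , F , refl
Occurs⇒plug (∨r {A = A} o) with X , E , F , refl ← Occurs⇒plug o = ∨R X A , E , F , refl
Occurs⇒plug (∧l {B = B} o) with X , E , F , refl ← Occurs⇒plug o = ∧L X B , E , F , refl
Occurs⇒plug (∧r {A = A} o) with X , E , F , refl ← Occurs⇒plug o = ∧R X A , E , F , refl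
Occurs⇒plug (⊓l {n = m} {B = B} o) with X , E , F , refl ← Occurs⇒plug o = ⊓L m X B , E , F , refl
Occurs⇒plug (⊓r {n = m} {A} o) with X , E , F , refl ← Occurs⇒plug o = ⊓R m X A , E , F , refl
Occurs⇒plug (⊔l {n = m} {B = B} o) with X , E , F , refl ← Occurs⇒plug o = ⊔L m X B , E , F , refl
Occurs⇒plug (⊔r {n = m} {A} o) with X , E , F , refl ← Occurs⇒plug o = ⊔R m X A , E , F , refl

Pure-⊓ : ∀ n A B → (∀ D′ → ¬ Step7a (⊓ᶜ n A B) D′) → (∀ D′ → ¬ Step7b (⊓ᶜ n A B) D′) → Pure (⊓ᶜ n A B)
Pure-⊓ n A B stuck₁ stuck₂ =
  Pure-nonbinary (λ ()) (λ ()) λ { _ _ _ refl → fresh-left ∘ Occurs⇒plug , fresh-right ∘ Occurs⇒plug }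
  where
  fresh-left : ¬ (∃[ X ] ∃[ E ] ∃[ F ] (A ≡ plug X (⊓ᶜ n E F)))
  fresh-left (X , E , F , refl) = stuck₁ _ (st X n E F B)
  fresh-right : ¬ (∃[ X ] ∃[ E ] ∃[ F ] (B ≡ plug X (⊓ᶜ n E F)))
  fresh-right (X , E , F , refl) = stuck₂ _ (st X n E F A)

R1a⇒>ˢ : R1a ⇒ _>ˢ_
R1a⇒>ˢ (l A) = s≤s (n≤1+n (size A))
R1a⇒>ˢ (r A) = s≤s (m≤m+n (size A) 1)

R1b⇒>ˢ : R1b ⇒ _>ˢ_
R1b⇒>ˢ (l A) = s≤s (s≤s z≤n)
R1b⇒>ˢ (r A) = s≤s (m≤n+m 1 (size A))

R5a⇒>ˢ : R5a ⇒ _>ˢ_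
R5a⇒>ˢ (l A) = s≤s (s≤s z≤n)
R5a⇒>ˢ (r A) = s≤s (m≤n+m 1 (size A))

R5b⇒>ˢ : R5b ⇒ _>ˢ_
R5b⇒>ˢ (l A) = s≤s (n≤1+n (size A))
R5b⇒>ˢ (r A) = s≤s (m≤m+n (size A) 1)

Step7a⇒>ˢ : Step7a ⇒ _>ˢ_
Step7a⇒>ˢ (st X c E F A) = s≤s (+-monoˡ-< (size A) (plug-size< X (s≤s (m≤m+n (size E) (size F)))))

Step7b⇒>ˢ : Step7b ⇒ _>ˢ_
Step7b⇒>ˢ (st X c E F A) = s≤s (+-monoʳ-< (size A) (plug-size< X (s≤s (m≤n+m (size F) (size E)))))

Invariant : (Cirq → Set) → Cirq → Cirq → Set
Invariant I D D′ = I D → I D′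

module _ {I : Cirq → Set} where

  Opt-invariant : S ⇒ Invariant I → Opt S ⇒ Invariant I
  Opt-invariant = Opt⇒ id

  Seq2-invariant : S₁ ⇒ Invariant I → S₂ ⇒ Invariant I → Seq2 S₁ S₂ ⇒ Invariant I
  Seq2-invariant = Seq2⇒ id (λ f g → g ∘ f)

  Loop-invariant : It ⇒ Invariant I → Loop It ⇒ Invariant I
  Loop-invariant = Loop⇒ (λ f g → g ∘ f)

Shape₅-after-stage5 : ∀ {A D₁ D₂ D₃ D₄ D₅} → Stage1 A D₁ → Stage2 D₁ D₂ → Stage3 D₂ D₃ →
  Stage4 D₃ D₄ → Stage5 D₄ D₅ → Shape₅ D₅
Shape₅-after-stage5 {D₁ = D₁} {D₂} {D₃} {D₄} {D₅} s₁ s₂ s₃ s₄ s₅ =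
  stage5-exit D₅ (Loop-invariant (Seq2-invariant R5a-preserves-Shape₄ R5b-preserves-Shape₄) s₅ shape₄)
    (proj₁ stuck₅) (proj₂ stuck₅)
  where
  stuck₁ : SurfNormal R1a D₁ × SurfNormal R1b D₁
  stuck₁ = Seq2-stuck size (SurfRw⇒>ˢ R1a⇒>ˢ) (SurfRw⇒>ˢ R1b⇒>ˢ) (Loop-fixpoint s₁)
  shape₁ : Shape₁ D₁
  shape₁ = stage1-exit D₁ (proj₁ stuck₁) (proj₂ stuck₁)
  shape₂ : Shape₂ D₂
  shape₂ = stage2-exit D₂ (Loop-invariant (Opt-invariant R2-preserves-Shape₁) s₂ shape₁)
    (Opt-stuck {S = SurfRw R2} (SurfRw-irreflexive {R = R2} λ ()) (Loop-fixpoint s₂))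
  shape₃ : Shape₃ D₃
  shape₃ = stage3-exit D₃ (Loop-invariant (Opt-invariant R3-preserves-Shape₂) s₃ shape₂)
    (Opt-stuck {S = SurfRw R3} (SurfRw-irreflexive {R = R3} λ ()) (Loop-fixpoint s₃))
  shape₄ : Shape₄ D₄
  shape₄ = stage4-exit D₄ (Loop-invariant (Opt-invariant R4-preserves-Shape₃) s₄ shape₃)
    (Opt-stuck {S = SurfRw R4} (SurfRw-irreflexive {R = R4} λ { (tr _ _ () _) }) (Loop-fixpoint s₄))
  stuck₅ : SurfNormal R5a D₅ × SurfNormal R5b D₅
  stuck₅ = Seq2-stuck size (SurfRw⇒>ˢ R5a⇒>ˢ) (SurfRw⇒>ˢ R5b⇒>ˢ) (Loop-fixpoint s₅)

Step7-preserves-IsMeet : Seq2 Step7a Step7b ⇒ Invariant IsMeet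
Step7-preserves-IsMeet = Seq2-invariant {S₁ = Step7a} {S₂ = Step7b}
  (λ { (st X c E F A) _ → c , _ , _ , refl }) (λ { (st X c E F A) _ → c , _ , _ , refl })

Step7-non-meet : ∀ {D D′} → ¬ IsMeet D → Seq2 Step7a Step7b D D′ → D′ ≡ D
Step7-non-meet ¬meet (_ , inj₁ (st X c E F A) , _) = ⊥-elim (¬meet (c , _ , _ , refl))
Step7-non-meet ¬meet (_ , inj₂ (refl , _) , inj₁ (st X c E F A)) = ⊥-elim (¬meet (c , _ , _ , refl))
Step7-non-meet ¬meet (_ , inj₂ (refl , _) , inj₂ (refl , _)) = refl

Pure-after-stage7 : ∀ {D B} → Shape₅ D → (∀ D′ → ¬ Step6 D D′) → Stage7 D B → Pure B
Pure-after-stage7 {D} shape stuck₆ s₇ with IsMeet? D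
... | yes m with n , E , F , refl ← Loop-invariant Step7-preserves-IsMeet s₇ m =
  Pure-⊓ n E F (proj₁ stuck₇) (proj₂ stuck₇)
  where
  stuck₇ : (∀ D′ → ¬ Step7a (⊓ᶜ n E F) D′) × (∀ D′ → ¬ Step7b (⊓ᶜ n E F) D′)
  stuck₇ = Seq2-stuck {S₁ = Step7a} {S₂ = Step7b} size Step7a⇒>ˢ Step7b⇒>ˢ (Loop-fixpoint s₇)
... | no ¬meet with refl ← Loop-trivial (Step7-non-meet ¬meet) s₇ with shape
...   | inj₁ refl = Pure-nonbinary (λ ()) (λ ()) λ _ _ _ ()
...   | inj₂ (inj₁ refl) = Pure-nonbinary (λ ()) (λ ()) λ _ _ _ ()
...   | inj₂ (inj₂ as) = Pure-AndOf D as ¬meet (Step6-normal⇒NoSurface⊓∧⊓ stuck₆)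

purification-Pure : ∀ {A B} → Purification A B → Pure B
purification-Pure (_ , _ , _ , _ , _ , _ , s₁ , s₂ , s₃ , s₄ , s₅ , s₆ , s₇) =
  Pure-after-stage7
    (Loop-invariant (Opt-invariant Step6-preserves-Shape₅) s₆ (Shape₅-after-stage5 s₁ s₂ s₃ s₄ s₅))
    (Opt-stuck {S = Step6} Step6-irreflexive (Loop-fixpoint s₆)) s₇

==C⇒≡ : ∀ c d → (c ==C d) ≡ true → c ≡ d
==C⇒≡ (conj m) (conj n) e = cong conj (≡ᵇ⇒≡ m n (subst Bool.T (sym e) tt))
==C⇒≡ (disj m) (disj n) e = cong disj (≡ᵇ⇒≡ m n (subst Bool.T (sym e) tt))

==C-refl : ∀ c → (c ==C c) ≡ true
==C-refl (conj m) = ≡ᵇ-refl m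
  where
  ≡ᵇ-refl : ∀ m → (m ℕ.≡ᵇ m) ≡ true
  ≡ᵇ-refl zero = refl
  ≡ᵇ-refl (suc m) = ≡ᵇ-refl m
==C-refl (disj m) = ==C-refl (conj m)

≢⇒==C-false : ∀ c d → c ≢ d → (c ==C d) ≡ false
≢⇒==C-false c d c≢d with c ==C d in eq
... | true = ⊥-elim (c≢d (==C⇒≡ c d eq))
... | false = refl

==P⇒≡ : ∀ p q → (p ==P q) ≡ true → p ≡ q
==P⇒≡ machine machine _ = refl
==P⇒≡ env env _ = refl

legal? : Player → Cluster → List Cluster → Bool
legal? p c seen = (owner c ==P p) Bool.∧ not (elemC c seen)

firstIllegal-∷ : ∀ seen p c x L → firstIllegal seen ((p , c , x) ∷ L) ≡ nothing →
  legal? p c seen ≡ true × firstIllegal (c ∷ seen) L ≡ nothing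
firstIllegal-∷ seen p c x L h with legal? p c seen
... | true = refl , h

legal-owner : ∀ {seen L p d x} → firstIllegal seen L ≡ nothing → (p , d , x) ∈ L → owner d ≡ p
legal-owner {seen} {(p , c , x) ∷ L} h (here refl) =
  ==P⇒≡ _ _ (∧-conicalˡ _ _ (proj₁ (firstIllegal-∷ seen p c x L h)))
legal-owner {seen} {(p , c , x) ∷ L} h (there m) = legal-owner (proj₂ (firstIllegal-∷ seen p c x L h)) m

legal-unseen : ∀ {seen L p d x} → firstIllegal seen L ≡ nothing → (p , d , x) ∈ L → elemC d seen ≡ false
legal-unseen {seen} {(p , c , x) ∷ L} h (here refl) =
  not≡true (∧-conicalʳ _ _ (proj₁ (firstIllegal-∷ seen p c x L h)))
  where
  not≡true : ∀ {b} → not b ≡ true → b ≡ false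
  not≡true {false} _ = refl
legal-unseen {seen} {(p , c , x) ∷ L} h (there m) =
  ∨-conicalʳ _ _ (legal-unseen (proj₂ (firstIllegal-∷ seen p c x L h)) m)

legal-head-fresh : ∀ {seen p c x L p′ y} → firstIllegal seen ((p , c , x) ∷ L) ≡ nothing →
  ¬ (p′ , c , y) ∈ L
legal-head-fresh {seen} {p} {c} {x} {L} h m
  with () ← trans (sym (legal-unseen (proj₂ (firstIllegal-∷ seen p c x L h)) m))
                  (cong (Bool._∨ elemC c seen) (==C-refl c))

legal-unique : ∀ {seen L p p′ d x y} → firstIllegal seen L ≡ nothing →
  (p , d , x) ∈ L → (p′ , d , y) ∈ L → x ≡ y
legal-unique h (here refl) (here refl) = refl
legal-unique {seen} {(p , c , x) ∷ L} h (here refl) (there m) =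
  ⊥-elim (legal-head-fresh {seen} {p} {c} {x} {L} h m)
legal-unique {seen} {(p , c , x) ∷ L} h (there m) (here refl) =
  ⊥-elim (legal-head-fresh {seen} {p} {c} {x} {L} h m)
legal-unique {seen} {(p , c , x) ∷ L} h (there m) (there m′) =
  legal-unique (proj₂ (firstIllegal-∷ seen p c x L h)) m m′

run : HPM → (ℕ → List Move) → ℕ → List LMove
run M e t = proj₂ (config M e t)

Legal : (ℕ → List LMove) → Set
Legal Γ = ∀ t → firstIllegal [] (Γ t) ≡ nothing

run-mono : ∀ M e t k {m} → m ∈ run M e t → m ∈ run M e (k + t)
run-mono M e t zero i = i
run-mono M e t (suc k) i = ∈-++⁺ˡ (∈-++⁺ˡ (run-mono M e t k i))

envMoves-∈⁺ : ∀ {m ms} → m ∈ ms → (env , m) ∈ envMoves ms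
envMoves-∈⁺ (here refl) = here refl
envMoves-∈⁺ (there i) = there (envMoves-∈⁺ i)

envMoves-∈⁻ : ∀ {p m ms} → (p , m) ∈ envMoves ms → m ∈ ms
envMoves-∈⁻ {ms = _ ∷ _} (here refl) = here refl
envMoves-∈⁻ {ms = _ ∷ _} (there i) = there (envMoves-∈⁻ i)

myMove-player : ∀ {p m mm} → (p , m) ∈ myMove mm → p ≡ machine
myMove-player {mm = just _} (here refl) = refl

env-move-∈-run : ∀ M e s {m} → m ∈ e s → (env , m) ∈ run M e (suc s)
env-move-∈-run M e s i = ∈-++⁺ˡ (∈-++⁺ʳ (run M e s) (envMoves-∈⁺ i))

env-move-origin : ∀ M e t {m} → (env , m) ∈ run M e t → ∃[ s ] (m ∈ e s)
env-move-origin M e (suc t) i with ∈-++⁻ (run M e t ++ envMoves (e t)) i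
... | inj₂ j with () ← myMove-player j
... | inj₁ j with ∈-++⁻ (run M e t) j
...   | inj₁ k = env-move-origin M e t k
...   | inj₂ k = t , envMoves-∈⁻ k

config-causal : ∀ M e e′ t → (∀ s → s < t → e s ≡ e′ s) → config M e t ≡ config M e′ t
config-causal M e e′ zero h = refl
config-causal M e e′ (suc t) h
  rewrite config-causal M e e′ t (λ s s<t → h s (m<n⇒m<1+n s<t)) | h t ≤-refl = refl

Resolution : Set₁
Resolution = Cluster → Bool → Set

AtMostOne : Resolution → Set
AtMostOne R = ∀ c → R c false → R c true → ⊥

Decided : Resolution → ℕ → Set
Decided R n = (∃[ x ] R (conj n) x) ⊎ (¬ R (conj n) false × ¬ R (conj n) true)

legal⇒AtMostOne : ∀ M e → Legal (run M e) → AtMostOne (Resolved (run M e))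
legal⇒AtMostOne M e legal c (t₁ , p₁ , m₁) (t₂ , p₂ , m₂)
  with () ← legal-unique (legal (t₂ + t₁)) (run-mono M e t₁ t₂ m₁)
              (subst (λ t → (p₂ , c , true) ∈ run M e t) (+-comm t₁ t₂) (run-mono M e t₂ t₁ m₂))

MachineLegal : HPM → Set
MachineLegal M = ∀ e → (∃[ t ] (firstIllegal [] (run M e t) ≡ just env)) ⊎ Legal (run M e)

Solves⇒MachineLegal : ∀ {M C} → (∀ I → Solves M C I) → MachineLegal M
Solves⇒MachineLegal sol e with sol (λ _ → true) e
... | inj₁ env-illegal = inj₁ env-illegal
... | inj₂ (legal , _) = inj₂ legal

hasConjMove : ℕ → List Move → Bool
hasConjMove n [] = false
hasConjMove n ((c , x) ∷ ms) = (c ==C conj n) Bool.∨ hasConjMove n ms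

hasConjMove-true : ∀ n ms → hasConjMove n ms ≡ true → ∃[ x ] ((conj n , x) ∈ ms)
hasConjMove-true n ((c , x) ∷ ms) h with c ==C conj n in eq
... | true rewrite ==C⇒≡ c (conj n) eq = x , here refl
... | false with y , i ← hasConjMove-true n ms h = y , there i

hasConjMove-false : ∀ n ms x → hasConjMove n ms ≡ false → ¬ (conj n , x) ∈ ms
hasConjMove-false n ((c , y) ∷ ms) x h (here refl)
  with () ← trans (sym h) (cong (Bool._∨ hasConjMove n ms) (==C-refl (conj n)))
hasConjMove-false n ((c , y) ∷ ms) x h (there i) = hasConjMove-false n ms x (∨-conicalʳ _ _ h) i

search< : ∀ (f : ℕ → Bool) t → (∃[ s ] (f s ≡ true)) ⊎ (∀ s → s < t → f s ≡ false)
search< f zero = inj₂ λ _ ()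
search< f (suc t) with search< f t
... | inj₁ found = inj₁ found
... | inj₂ below with f t in eq
...   | true = inj₁ (t , eq)
...   | false = inj₂ λ s s<1+t → [ below s , (λ { refl → eq }) ]′ (m<1+n⇒m<n∨m≡n s<1+t)

-- Every batch of environment moves containing a move in conj n is followed by an illegal move in
-- disj 0. Against the probe a machine that never moves illegally first thus either meets an
-- illegal environment move, and a bounded search finds the move in conj n, or sees a legal run,
-- in which the environment never moves in conj n.
probe : ℕ → (ℕ → List Move) → ℕ → List Move
probe n e s = Bool.if hasConjMove n (e s) then e s ++ (disj 0 , false) ∷ [] else e s

probe-illegal : ∀ n e s → hasConjMove n (e s) ≡ true → (disj 0 , false) ∈ probe n e s
probe-illegal n e s h rewrite h = ∈-++⁺ʳ (e s) (here refl)

probe-legal⇒no-conj-move : ∀ M n e → Legal (run M (probe n e)) → ∀ s → hasConjMove n (e s) ≡ false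
probe-legal⇒no-conj-move M n e probe-legal s with hasConjMove n (e s) in eq
... | false = refl
... | true with () ← legal-owner (probe-legal (suc s))
                        (env-move-∈-run M (probe n e) s (probe-illegal n e s eq))

probe-agrees : ∀ n e t → (∀ s → s < t → hasConjMove n (e s) ≡ false) → ∀ s → s < t → e s ≡ probe n e s
probe-agrees n e t none s s<t rewrite none s s<t = refl

Resolution-decided : ∀ M → MachineLegal M → ∀ e → Legal (run M e) → ∀ n → Decided (Resolved (run M e)) n
Resolution-decided M machine-legal e legal n with machine-legal (probe n e)
... | inj₂ probe-legal = inj₂ (unresolved false , unresolved true)
  where
  unresolved : ∀ x → ¬ Resolved (run M e) (conj n) x
  unresolved x (t , machine , m) with () ← legal-owner (legal t) m
  unresolved x (t , env , m) with s , i ← env-move-origin M e t m =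
    hasConjMove-false n (e s) x (probe-legal⇒no-conj-move M n e probe-legal s) i
... | inj₁ (t , illegal) with search< (λ s → hasConjMove n (e s)) t
...   | inj₁ (s , h) with x , i ← hasConjMove-true n (e s) h =
  inj₁ (x , suc s , env , env-move-∈-run M e s i)
...   | inj₂ none with () ← trans (sym (legal t)) (trans (cong (firstIllegal [] ∘ proj₂)
          (config-causal M e (probe n e) t (probe-agrees n e t none))) illegal)

module _ {I : ℕ → Bool} {R : Resolution} where

  Won-plug : ∀ X {P Q} → (Won I R P → Won I R Q) → Won I R (plug X P) → Won I R (plug X Q)
  Won-plug ∙ f w = f w
  Won-plug (∨L X B) f (inj₁ w) = inj₁ (Won-plug X f w)
  Won-plug (∨L X B) f (inj₂ w) = inj₂ w
  Won-plug (∨R X A) f (inj₁ w) = inj₁ w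
  Won-plug (∨R X A) f (inj₂ w) = inj₂ (Won-plug X f w)
  Won-plug (∧L X B) f (w , v) = Won-plug X f w , v
  Won-plug (∧R X A) f (v , w) = v , Won-plug X f w
  Won-plug (⊓L n X B) f (inj₁ (inj₁ u)) = inj₁ (inj₁ u)
  Won-plug (⊓L n X B) f (inj₁ (inj₂ (r₀ , w))) = inj₁ (inj₂ (r₀ , Won-plug X f w))
  Won-plug (⊓L n X B) f (inj₂ w) = inj₂ w
  Won-plug (⊓R n X A) f (inj₁ w) = inj₁ w
  Won-plug (⊓R n X A) f (inj₂ (r₁ , w)) = inj₂ (r₁ , Won-plug X f w)
  Won-plug (⊔L n X B) f (inj₁ (r₀ , w)) = inj₁ (r₀ , Won-plug X f w)
  Won-plug (⊔L n X B) f (inj₂ w) = inj₂ w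
  Won-plug (⊔R n X A) f (inj₁ w) = inj₁ w
  Won-plug (⊔R n X A) f (inj₂ (r₁ , w)) = inj₂ (r₁ , Won-plug X f w)

  Won-splug : ∀ X {P Q} → (Won I R P → Won I R Q) → Won I R (splug X P) → Won I R (splug X Q)
  Won-splug X {P} {Q} f w =
    subst (Won I R) (sym (splug≡plug X Q)) (Won-plug (toCtx X) f (subst (Won I R) (splug≡plug X P) w))

  Won-VComp : ∀ {E F} → VComp E F → Won I R F → Won I R E
  Won-VComp self w = w
  Won-VComp (∨l v) w = inj₁ (Won-VComp v w)
  Won-VComp (∨r v) w = inj₂ (Won-VComp v w)

TruthTransfer : Cirq → Cirq → Set₁
TruthTransfer D D′ = ∀ I R → AtMostOne R → (∀ n → Decided R n) → Won I R D → Won I R D′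

TruthTransfer⇒Valid : ∀ {D D′} → TruthTransfer D D′ → Valid D → Valid D′
TruthTransfer⇒Valid {D} {D′} transfer (M , sol) = M , λ I e → won I e (sol I e)
  where
  won : ∀ I e → WonRun I D (run M e) → WonRun I D′ (run M e)
  won I e (inj₁ env-illegal) = inj₁ env-illegal
  won I e (inj₂ (legal , w)) = inj₂ (legal , transfer I _ (legal⇒AtMostOne M e legal)
    (Resolution-decided M (Solves⇒MachineLegal sol) e legal) w)

infix 4 _≈ᵛ_
_≈ᵛ_ : Cirq → Cirq → Set₁
D ≈ᵛ D′ = Valid D ⇔ Valid D′

TruthTransfer⇒≈ᵛ : ∀ {D D′} → TruthTransfer D D′ → TruthTransfer D′ D → D ≈ᵛ D′
TruthTransfer⇒≈ᵛ to from = mk⇔ (TruthTransfer⇒Valid to) (TruthTransfer⇒Valid from)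

SurfRw⇒≈ᵛ : ∀ {Rw : Cirq → Cirq → Set} → (∀ {P Q} → Rw P Q → TruthTransfer P Q) →
  (∀ {P Q} → Rw P Q → TruthTransfer Q P) → SurfRw Rw ⇒ _≈ᵛ_
SurfRw⇒≈ᵛ to from (rw X ρ) = TruthTransfer⇒≈ᵛ
  (λ I R amo dec → Won-splug X (to ρ I R amo dec)) (λ I R amo dec → Won-splug X (from ρ I R amo dec))

module _ {I : ℕ → Bool} {R : Resolution} where

  Won-∨-swap : ∀ {A B} → Won I R (A ∨ᶜ B) → Won I R (B ∨ᶜ A)
  Won-∨-swap (inj₁ w) = inj₂ w
  Won-∨-swap (inj₂ w) = inj₁ w

  Won-⊓∨-distrib : ∀ c A B C → Decided R c → Won I R (⊓ᶜ c A B ∨ᶜ C) → Won I R (⊓ᶜ c (A ∨ᶜ C) (B ∨ᶜ C))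
  Won-⊓∨-distrib c A B C _ (inj₁ (inj₁ (inj₁ u))) = inj₁ (inj₁ u)
  Won-⊓∨-distrib c A B C _ (inj₁ (inj₁ (inj₂ (r₀ , w)))) = inj₁ (inj₂ (r₀ , inj₁ w))
  Won-⊓∨-distrib c A B C _ (inj₁ (inj₂ (r₁ , w))) = inj₂ (r₁ , inj₁ w)
  Won-⊓∨-distrib c A B C (inj₁ (false , r₀)) (inj₂ w) = inj₁ (inj₂ (r₀ , inj₂ w))
  Won-⊓∨-distrib c A B C (inj₁ (true , r₁)) (inj₂ w) = inj₂ (r₁ , inj₂ w)
  Won-⊓∨-distrib c A B C (inj₂ u) (inj₂ w) = inj₁ (inj₁ u)

  Won-⊓∨-factor : ∀ c A B C → Won I R (⊓ᶜ c (A ∨ᶜ C) (B ∨ᶜ C)) → Won I R (⊓ᶜ c A B ∨ᶜ C)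
  Won-⊓∨-factor c A B C (inj₁ (inj₁ u)) = inj₁ (inj₁ (inj₁ u))
  Won-⊓∨-factor c A B C (inj₁ (inj₂ (r₀ , inj₁ w))) = inj₁ (inj₁ (inj₂ (r₀ , w)))
  Won-⊓∨-factor c A B C (inj₁ (inj₂ (r₀ , inj₂ w))) = inj₂ w
  Won-⊓∨-factor c A B C (inj₂ (r₁ , inj₁ w)) = inj₁ (inj₂ (r₁ , w))
  Won-⊓∨-factor c A B C (inj₂ (r₁ , inj₂ w)) = inj₂ w

  Won-complementary : ∀ {E p} → VComp E (pos p) → VComp E (neg p) → Won I R E
  Won-complementary {p = p} v⁺ v⁻ with I p in eq
  ... | true = Won-VComp v⁺ eq
  ... | false = Won-VComp v⁻ eq

  Won-quadrilemma⁺ : ∀ a b c A B E F → Decided R c →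
    Won I R (⊓ᶜ a A B ∧ᶜ ⊓ᶜ b E F) → Won I R (quadPrem a b c A B E F)
  Won-quadrilemma⁺ a b c A B E F (inj₂ u) _ = inj₁ (inj₁ u)
  Won-quadrilemma⁺ a b c A B E F (inj₁ (false , r₀)) (wAB , wEF) = inj₁ (inj₂ (r₀ , with-EF wAB))
    where
    with-EF : Won I R (⊓ᶜ a A B) → Won I R (⊓ᶜ a (A ∧ᶜ ⊓ᶜ b E F) (B ∧ᶜ ⊓ᶜ b E F))
    with-EF (inj₁ (inj₁ u)) = inj₁ (inj₁ u)
    with-EF (inj₁ (inj₂ (x , w))) = inj₁ (inj₂ (x , (w , wEF)))
    with-EF (inj₂ (x , w)) = inj₂ (x , (w , wEF))
  Won-quadrilemma⁺ a b c A B E F (inj₁ (true , r₁)) (wAB , wEF) = inj₂ (r₁ , with-AB wEF)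
    where
    with-AB : Won I R (⊓ᶜ b E F) → Won I R (⊓ᶜ b (⊓ᶜ a A B ∧ᶜ E) (⊓ᶜ a A B ∧ᶜ F))
    with-AB (inj₁ (inj₁ u)) = inj₁ (inj₁ u)
    with-AB (inj₁ (inj₂ (x , w))) = inj₁ (inj₂ (x , (wAB , w)))
    with-AB (inj₂ (x , w)) = inj₂ (x , (wAB , w))

Step7a-≈ᵛ : Step7a ⇒ _≈ᵛ_
Step7a-≈ᵛ (st X c E F A) = TruthTransfer⇒≈ᵛ {⊓ᶜ c (plug X (⊓ᶜ c E F)) A} {⊓ᶜ c (plug X E) A} to from
  where
  to : TruthTransfer (⊓ᶜ c (plug X (⊓ᶜ c E F)) A) (⊓ᶜ c (plug X E) A)
  to I R amo _ (inj₁ (inj₁ u)) = inj₁ (inj₁ u)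
  to I R amo _ (inj₁ (inj₂ (r₀ , w))) = inj₁ (inj₂ (r₀ , Won-plug X left w))
    where
    left : Won I R (⊓ᶜ c E F) → Won I R E
    left (inj₁ (inj₁ (¬r₀ , _))) = ⊥-elim (¬r₀ r₀)
    left (inj₁ (inj₂ (_ , wE))) = wE
    left (inj₂ (r₁ , _)) = ⊥-elim (amo (conj c) r₀ r₁)
  to I R amo _ (inj₂ w) = inj₂ w
  from : TruthTransfer (⊓ᶜ c (plug X E) A) (⊓ᶜ c (plug X (⊓ᶜ c E F)) A)
  from I R _ _ (inj₁ (inj₁ u)) = inj₁ (inj₁ u)
  from I R _ _ (inj₁ (inj₂ (r₀ , w))) = inj₁ (inj₂ (r₀ , Won-plug X (λ wE → inj₁ (inj₂ (r₀ , wE))) w))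
  from I R _ _ (inj₂ w) = inj₂ w

Step7b-≈ᵛ : Step7b ⇒ _≈ᵛ_
Step7b-≈ᵛ (st X c E F A) = TruthTransfer⇒≈ᵛ {⊓ᶜ c A (plug X (⊓ᶜ c E F))} {⊓ᶜ c A (plug X F)} to from
  where
  to : TruthTransfer (⊓ᶜ c A (plug X (⊓ᶜ c E F))) (⊓ᶜ c A (plug X F))
  to I R amo _ (inj₁ u) = inj₁ u
  to I R amo _ (inj₂ (r₁ , w)) = inj₂ (r₁ , Won-plug X right w)
    where
    right : Won I R (⊓ᶜ c E F) → Won I R F
    right (inj₁ (inj₁ (_ , ¬r₁))) = ⊥-elim (¬r₁ r₁)
    right (inj₁ (inj₂ (r₀ , _))) = ⊥-elim (amo (conj c) r₀ r₁)
    right (inj₂ (_ , wF)) = wF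
  from : TruthTransfer (⊓ᶜ c A (plug X F)) (⊓ᶜ c A (plug X (⊓ᶜ c E F)))
  from I R _ _ (inj₁ u) = inj₁ u
  from I R _ _ (inj₂ (r₁ , w)) = inj₂ (r₁ , Won-plug X (λ wF → inj₂ (r₁ , wF)) w)

-- Environment moves are relabelled by an injection of ℕ that avoids c and fixes every n < N other
-- than c, so they cannot clash with the inserted moves in c while the clusters of the cirquent
-- (all below N) are untouched.
module QuadrilemmaSimulation (a b c N : ℕ) (c<N : c < N) where

  relabel : ℕ → ℕ
  relabel n with n ≟ c
  ... | yes _ = N
  ... | no _ with n <? N
  ...   | yes _ = n
  ...   | no _ = suc n

  relabel-view : ∀ n → (n ≡ c × relabel n ≡ N)
                      ⊎ ((n ≢ c × n < N × relabel n ≡ n) ⊎ (n ≢ c × ¬ n < N × relabel n ≡ suc n))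
  relabel-view n with n ≟ c
  ... | yes e = inj₁ (e , refl)
  ... | no ne with n <? N
  ...   | yes lt = inj₂ (inj₁ (ne , lt , refl))
  ...   | no nlt = inj₂ (inj₂ (ne , nlt , refl))

  relabel≢c : ∀ n → relabel n ≢ c
  relabel≢c n with relabel-view n
  ... | inj₁ (_ , e) = λ e′ → <-irrefl (trans (sym e′) e) c<N
  ... | inj₂ (inj₁ (ne , _ , e)) = λ e′ → ne (trans (sym e) e′)
  ... | inj₂ (inj₂ (_ , nlt , e)) = λ e′ → nlt (<-trans (subst (n <_) (trans (sym e) e′) (n<1+n n)) c<N)

  relabel-fixes : ∀ n → n < N → n ≢ c → relabel n ≡ n
  relabel-fixes n lt ne with relabel-view n
  ... | inj₁ (e , _) = ⊥-elim (ne e)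
  ... | inj₂ (inj₁ (_ , _ , e)) = e
  ... | inj₂ (inj₂ (_ , nlt , _)) = ⊥-elim (nlt lt)

  relabel-injective : ∀ n m → relabel n ≡ relabel m → n ≡ m
  relabel-injective n m h with relabel-view n | relabel-view m
  ... | inj₁ (e1 , _) | inj₁ (e2 , _) = trans e1 (sym e2)
  ... | inj₁ (_ , f1) | inj₂ (inj₁ (_ , lt , f2)) = ⊥-elim (<-irrefl (trans (sym f2) (trans (sym h) f1)) lt)
  ... | inj₁ (_ , f1) | inj₂ (inj₂ (_ , nlt , f2)) =
        ⊥-elim (nlt (subst (m <_) (trans (sym f2) (trans (sym h) f1)) (n<1+n m)))
  ... | inj₂ (inj₁ (_ , lt , f1)) | inj₁ (_ , f2) = ⊥-elim (<-irrefl (trans (sym f1) (trans h f2)) lt)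
  ... | inj₂ (inj₂ (_ , nlt , f1)) | inj₁ (_ , f2) =
        ⊥-elim (nlt (subst (n <_) (trans (sym f1) (trans h f2)) (n<1+n n)))
  ... | inj₂ (inj₁ (_ , _ , f1)) | inj₂ (inj₁ (_ , _ , f2)) = trans (sym f1) (trans h f2)
  ... | inj₂ (inj₁ (_ , lt , f1)) | inj₂ (inj₂ (_ , nlt , f2)) =
        ⊥-elim (nlt (<-trans (subst (m <_) (trans (sym f2) (trans (sym h) f1)) (n<1+n m)) lt))
  ... | inj₂ (inj₂ (_ , nlt , f1)) | inj₂ (inj₁ (_ , lt , f2)) =
        ⊥-elim (nlt (<-trans (subst (n <_) (trans (sym f1) (trans h f2)) (n<1+n n)) lt))
  ... | inj₂ (inj₂ (_ , _ , f1)) | inj₂ (inj₂ (_ , _ , f2)) = suc-injective (trans (sym f1) (trans h f2))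

  relabelᶜ : Cluster → Cluster
  relabelᶜ (conj n) = conj (relabel n)
  relabelᶜ (disj n) = disj n

  relabelᶜ-injective : ∀ x y → relabelᶜ x ≡ relabelᶜ y → x ≡ y
  relabelᶜ-injective (conj n) (conj m) e =
    cong conj (relabel-injective n m (cong (λ { (conj k) → k ; (disj k) → k }) e))
  relabelᶜ-injective (disj n) (disj m) refl = refl

  relabelᶜ≢c : ∀ x → relabelᶜ x ≢ conj c
  relabelᶜ≢c (conj n) e = relabel≢c n (cong (λ { (conj k) → k ; (disj k) → k }) e)
  relabelᶜ≢c (disj n) ()

  owner-relabelᶜ : ∀ x → owner (relabelᶜ x) ≡ owner x
  owner-relabelᶜ (conj n) = refl
  owner-relabelᶜ (disj n) = refl

  ==C-relabelᶜ : ∀ x y → (relabelᶜ x ==C relabelᶜ y) ≡ (x ==C y)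
  ==C-relabelᶜ x y with x ==C y in eq
  ... | true rewrite ==C⇒≡ x y eq = ==C-refl (relabelᶜ y)
  ... | false = ≢⇒==C-false (relabelᶜ x) (relabelᶜ y) λ e → case (relabelᶜ-injective x y e)
    where
    case : x ≡ y → ⊥
    case refl with () ← trans (sym eq) (==C-refl x)

  c==C-relabelᶜ : ∀ x → (conj c ==C relabelᶜ x) ≡ false
  c==C-relabelᶜ x = ≢⇒==C-false (conj c) (relabelᶜ x) λ e → relabelᶜ≢c x (sym e)
  relabelᶜ==C-c : ∀ x → (relabelᶜ x ==C conj c) ≡ false
  relabelᶜ==C-c x = ≢⇒==C-false (relabelᶜ x) (conj c) (relabelᶜ≢c x)

  inAB : Cluster → Bool
  inAB d = (d ==C conj a) Bool.∨ (d ==C conj b)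

  inAB-a : inAB (conj a) ≡ true
  inAB-a = cong (Bool._∨ (conj a ==C conj b)) (==C-refl (conj a))

  inAB-b : inAB (conj b) ≡ true
  inAB-b = trans (cong ((conj b ==C conj a) Bool.∨_) (==C-refl (conj b))) (∨-zeroʳ _)

  -- The flag records whether the environment has already moved in a or b; before its first such
  -- move, c.0 (move in a) or c.1 (move in b) is inserted.
  mutual
    translate : Bool → List LMove → List LMove
    translate done [] = []
    translate done ((machine , m) ∷ Γ) = (machine , m) ∷ translate done Γ
    translate done ((env , d , x) ∷ Γ) = translateEnvMove done (inAB d) d x Γ

    translateEnvMove : Bool → Bool → Cluster → Bool → List LMove → List LMove
    translateEnvMove false true d x Γ =
      (env , conj c , not (d ==C conj a)) ∷ (env , relabelᶜ d , x) ∷ translate true Γ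
    translateEnvMove done _ d x Γ = (env , relabelᶜ d , x) ∷ translate done Γ

  inserted : Bool → List LMove → Bool
  inserted done [] = done
  inserted done ((machine , m) ∷ Γ) = inserted done Γ
  inserted done ((env , d , x) ∷ Γ) = inserted (done Bool.∨ inAB d) Γ

  mutual
    translateMoves : Bool → List Move → List Move
    translateMoves done [] = []
    translateMoves done ((d , x) ∷ ms) = translateMove done (inAB d) d x ms

    translateMove : Bool → Bool → Cluster → Bool → List Move → List Move
    translateMove false true d x ms =
      (conj c , not (d ==C conj a)) ∷ (relabelᶜ d , x) ∷ translateMoves true ms
    translateMove done _ d x ms = (relabelᶜ d , x) ∷ translateMoves done ms

  translate-++ : ∀ done Γ₁ Γ₂ →
    translate done (Γ₁ ++ Γ₂) ≡ translate done Γ₁ ++ translate (inserted done Γ₁) Γ₂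
  translate-++ done [] Γ₂ = refl
  translate-++ done ((machine , m) ∷ Γ₁) Γ₂ = cong ((machine , m) ∷_) (translate-++ done Γ₁ Γ₂)
  translate-++ done ((env , d , x) ∷ Γ₁) Γ₂ with done | inAB d
  ... | false | true = cong (λ Γ → (env , conj c , not (d ==C conj a)) ∷ (env , relabelᶜ d , x) ∷ Γ)
                            (translate-++ true Γ₁ Γ₂)
  ... | false | false = cong ((env , relabelᶜ d , x) ∷_) (translate-++ false Γ₁ Γ₂)
  ... | true | _ = cong ((env , relabelᶜ d , x) ∷_) (translate-++ true Γ₁ Γ₂)

  inserted-++ : ∀ done Γ₁ Γ₂ → inserted done (Γ₁ ++ Γ₂) ≡ inserted (inserted done Γ₁) Γ₂
  inserted-++ done [] Γ₂ = refl
  inserted-++ done ((machine , m) ∷ Γ₁) Γ₂ = inserted-++ done Γ₁ Γ₂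
  inserted-++ done ((env , d , x) ∷ Γ₁) Γ₂ = inserted-++ (done Bool.∨ inAB d) Γ₁ Γ₂

  translate-envMoves : ∀ done ms → translate done (envMoves ms) ≡ envMoves (translateMoves done ms)
  translate-envMoves done [] = refl
  translate-envMoves done ((d , x) ∷ ms) with done | inAB d
  ... | false | true = cong (λ Γ → (env , conj c , not (d ==C conj a)) ∷ (env , relabelᶜ d , x) ∷ Γ)
                            (translate-envMoves true ms)
  ... | false | false = cong ((env , relabelᶜ d , x) ∷_) (translate-envMoves false ms)
  ... | true | _ = cong ((env , relabelᶜ d , x) ∷_) (translate-envMoves true ms)

  translate-++-myMove : ∀ Γ mm → translate false (Γ ++ myMove mm) ≡ translate false Γ ++ myMove mm
  translate-++-myMove Γ nothing = translate-++ false Γ []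
  translate-++-myMove Γ (just m) = translate-++ false Γ (myMove (just m))

  inserted-++-myMove : ∀ Γ mm → inserted false (Γ ++ myMove mm) ≡ inserted false Γ
  inserted-++-myMove Γ nothing = inserted-++ false Γ []
  inserted-++-myMove Γ (just m) = inserted-++ false Γ (myMove (just m))

  simulator : HPM → HPM
  simulator M = record
    { State = HPM.State M ; start = HPM.start M ; step = λ s Γ → HPM.step M s (translate false Γ) }

  insertedBefore : (ℕ → List Move) → ℕ → Bool
  insertedBefore e zero = false
  insertedBefore e (suc t) = inserted (insertedBefore e t) (envMoves (e t))

  simulatedEnv : (ℕ → List Move) → ℕ → List Move
  simulatedEnv e t = translateMoves (insertedBefore e t) (e t)

  config-simulation : ∀ M e t →
    config M (simulatedEnv e) t ≡ (proj₁ (config (simulator M) e t) , translate false (run (simulator M) e t))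
    × inserted false (run (simulator M) e t) ≡ insertedBefore e t
  config-simulation M e zero = refl , refl
  config-simulation M e (suc t) with config≡ , inserted≡ ← config-simulation M e t = config≡′ , inserted≡′
    where
    s : HPM.State M
    s = proj₁ (config (simulator M) e t)
    Γ Γ′ : List LMove
    Γ = run (simulator M) e t
    Γ′ = Γ ++ envMoves (e t)
    translate-Γ′ : translate false Γ′ ≡ translate false Γ ++ envMoves (simulatedEnv e t)
    translate-Γ′ = trans (translate-++ false Γ (envMoves (e t)))
      (cong (translate false Γ ++_) (trans (cong (λ done → translate done (envMoves (e t))) inserted≡)
                                           (translate-envMoves (insertedBefore e t) (e t))))
    config≡′ : config M (simulatedEnv e) (suc t)
             ≡ (proj₁ (config (simulator M) e (suc t)) , translate false (run (simulator M) e (suc t)))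
    config≡′ rewrite config≡ | sym translate-Γ′ =
      cong (proj₁ (HPM.step M s (translate false Γ′)) ,_) (sym (translate-++-myMove Γ′ _))
    inserted≡′ : inserted false (run (simulator M) e (suc t)) ≡ insertedBefore e (suc t)
    inserted≡′ = begin
      inserted false (Γ′ ++ myMove _)              ≡⟨ inserted-++-myMove Γ′ _ ⟩
      inserted false Γ′                            ≡⟨ inserted-++ false Γ (envMoves (e t)) ⟩
      inserted (inserted false Γ) (envMoves (e t))
        ≡⟨ cong (λ done → inserted done (envMoves (e t))) inserted≡ ⟩
      insertedBefore e (suc t)                     ∎
      where open ≡-Reasoning

  run-simulation : ∀ M e t → run M (simulatedEnv e) t ≡ translate false (run (simulator M) e t)
  run-simulation M e t = cong proj₂ (proj₁ (config-simulation M e t))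

  SeenMatch : List Cluster → List Cluster → Bool → Set
  SeenMatch seen seen′ done =
    (∀ d → elemC (relabelᶜ d) seen′ ≡ elemC d seen) × (elemC (conj c) seen′ ≡ done)

  legal?-relabelᶜ : ∀ p d seen seen′ → elemC (relabelᶜ d) seen′ ≡ elemC d seen →
    legal? p (relabelᶜ d) seen′ ≡ legal? p d seen
  legal?-relabelᶜ p d seen seen′ h rewrite owner-relabelᶜ d | h = refl

  SeenMatch-∷ : ∀ {seen seen′ done} d → SeenMatch seen seen′ done →
    SeenMatch (d ∷ seen) (relabelᶜ d ∷ seen′) done
  SeenMatch-∷ d (relabelled , c-seen) =
    (λ d′ → cong₂ Bool._∨_ (==C-relabelᶜ d′ d) (relabelled d′)) , cong₂ Bool._∨_ (c==C-relabelᶜ d) c-seen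

  SeenMatch-insert : ∀ {seen seen′ done} d → SeenMatch seen seen′ done →
    SeenMatch (d ∷ seen) (relabelᶜ d ∷ conj c ∷ seen′) true
  SeenMatch-insert {seen′ = seen′} d (relabelled , _) =
    (λ d′ → cong₂ Bool._∨_ (==C-relabelᶜ d′ d) (cong₂ Bool._∨_ (relabelᶜ==C-c d′) (relabelled d′))) ,
    cong₂ Bool._∨_ (c==C-relabelᶜ d) (cong (Bool._∨ elemC (conj c) seen′) (==C-refl (conj c)))

  firstIllegal-translate : ∀ Γ seen seen′ done → SeenMatch seen seen′ done →
    firstIllegal seen′ (translate done Γ) ≡ firstIllegal seen Γ
  firstIllegal-translate [] seen seen′ done match = refl
  firstIllegal-translate ((machine , conj n , x) ∷ Γ) seen seen′ done match = refl
  firstIllegal-translate ((machine , disj n , x) ∷ Γ) seen seen′ done match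
    rewrite proj₁ match (disj n) with elemC (disj n) seen
  ... | true = refl
  ... | false =
    firstIllegal-translate Γ (disj n ∷ seen) (disj n ∷ seen′) done (SeenMatch-∷ {seen} {seen′} (disj n) match)
  firstIllegal-translate ((env , d , x) ∷ Γ) seen seen′ true match
    with legal? env (relabelᶜ d) seen′ | legal? env d seen | legal?-relabelᶜ env d seen seen′ (proj₁ match d)
  ... | true | true | refl =
    firstIllegal-translate Γ (d ∷ seen) (relabelᶜ d ∷ seen′) true (SeenMatch-∷ {seen} {seen′} d match)
  ... | false | false | refl = refl
  firstIllegal-translate ((env , d , x) ∷ Γ) seen seen′ false match with inAB d
  ... | false
    with legal? env (relabelᶜ d) seen′ | legal? env d seen | legal?-relabelᶜ env d seen seen′ (proj₁ match d)
  ...   | true | true | refl =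
    firstIllegal-translate Γ (d ∷ seen) (relabelᶜ d ∷ seen′) false (SeenMatch-∷ {seen} {seen′} d match)
  ...   | false | false | refl = refl
  firstIllegal-translate ((env , d , x) ∷ Γ) seen seen′ false match | true
    with legal? env (relabelᶜ d) (conj c ∷ seen′) | legal? env d seen
       | legal?-relabelᶜ env d seen (conj c ∷ seen′)
           (trans (cong (Bool._∨ elemC (relabelᶜ d) seen′) (relabelᶜ==C-c d)) (proj₁ match d))
  ...   | true | true | refl rewrite proj₂ match =
    firstIllegal-translate Γ (d ∷ seen) (relabelᶜ d ∷ conj c ∷ seen′) true
      (SeenMatch-insert {seen} {seen′} d match)
  ...   | false | false | refl rewrite proj₂ match = refl

  firstIllegal-translate[] : ∀ Γ → firstIllegal [] (translate false Γ) ≡ firstIllegal [] Γ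
  firstIllegal-translate[] Γ = firstIllegal-translate Γ [] [] false ((λ d → refl) , refl)

  relabelBy : Player → Cluster → Cluster
  relabelBy machine d = d
  relabelBy env d = relabelᶜ d

  translate-∈⁺ : ∀ done Γ {p d x} → (p , d , x) ∈ Γ → (p , relabelBy p d , x) ∈ translate done Γ
  translate-∈⁺ done ((machine , m) ∷ Γ) (here refl) = here refl
  translate-∈⁺ done ((machine , m) ∷ Γ) (there i) = there (translate-∈⁺ done Γ i)
  translate-∈⁺ true ((env , d₁ , x₁) ∷ Γ) (here refl) = here refl
  translate-∈⁺ true ((env , d₁ , x₁) ∷ Γ) (there i) = there (translate-∈⁺ true Γ i)
  translate-∈⁺ false ((env , d₁ , x₁) ∷ Γ) i with inAB d₁
  translate-∈⁺ false ((env , d₁ , x₁) ∷ Γ) (here refl) | true = there (here refl)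
  translate-∈⁺ false ((env , d₁ , x₁) ∷ Γ) (there i) | true = there (there (translate-∈⁺ true Γ i))
  translate-∈⁺ false ((env , d₁ , x₁) ∷ Γ) (here refl) | false = here refl
  translate-∈⁺ false ((env , d₁ , x₁) ∷ Γ) (there i) | false = there (translate-∈⁺ false Γ i)

  TranslatedFrom : Player → Cluster → Bool → List LMove → Set
  TranslatedFrom p d′ x Γ = (Σ Cluster λ d → ((p , d , x) ∈ Γ) × d′ ≡ relabelBy p d) ⊎ (p ≡ env × d′ ≡ conj c)

  TranslatedFrom-there : ∀ {p d′ x y Γ} → TranslatedFrom p d′ x Γ → TranslatedFrom p d′ x (y ∷ Γ)
  TranslatedFrom-there (inj₁ (d , i , e)) = inj₁ (d , there i , e)
  TranslatedFrom-there (inj₂ z) = inj₂ z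

  translate-∈⁻ : ∀ done Γ {p d′ x} → (p , d′ , x) ∈ translate done Γ → TranslatedFrom p d′ x Γ
  translate-∈⁻ done ((machine , m) ∷ Γ) (here refl) = inj₁ (_ , here refl , refl)
  translate-∈⁻ done ((machine , m) ∷ Γ) (there i) = TranslatedFrom-there (translate-∈⁻ done Γ i)
  translate-∈⁻ true ((env , d₁ , x₁) ∷ Γ) (here refl) = inj₁ (d₁ , here refl , refl)
  translate-∈⁻ true ((env , d₁ , x₁) ∷ Γ) (there i) = TranslatedFrom-there (translate-∈⁻ true Γ i)
  translate-∈⁻ false ((env , d₁ , x₁) ∷ Γ) i with inAB d₁
  translate-∈⁻ false ((env , d₁ , x₁) ∷ Γ) (here refl) | true = inj₂ (refl , refl)
  translate-∈⁻ false ((env , d₁ , x₁) ∷ Γ) (there (here refl)) | true = inj₁ (d₁ , here refl , refl)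
  translate-∈⁻ false ((env , d₁ , x₁) ∷ Γ) (there (there i)) | true =
    TranslatedFrom-there (translate-∈⁻ true Γ i)
  translate-∈⁻ false ((env , d₁ , x₁) ∷ Γ) (here refl) | false = inj₁ (d₁ , here refl , refl)
  translate-∈⁻ false ((env , d₁ , x₁) ∷ Γ) (there i) | false = TranslatedFrom-there (translate-∈⁻ false Γ i)

  InsertedC : Bool → List LMove → Player → Bool → Set
  InsertedC done Γ p y = p ≡ machine ⊎
    (∃[ d ] ∃[ x ] ((env , relabelᶜ d , x) ∈ translate done Γ × inAB d ≡ true × y ≡ not (d ==C conj a)))

  clusterOf : LMove → Cluster
  clusterOf (_ , d , _) = d

  relabelᶜ-not-c : ∀ {p y} d₁ {x₁} → (p , conj c , y) ≡ (env , relabelᶜ d₁ , x₁) → ⊥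
  relabelᶜ-not-c d₁ e = relabelᶜ≢c d₁ (sym (cong clusterOf e))

  translate-c-move : ∀ done Γ {p y} → (p , conj c , y) ∈ translate done Γ → InsertedC done Γ p y
  translate-c-move done ((machine , m) ∷ Γ) (here refl) = inj₁ refl
  translate-c-move done ((machine , m) ∷ Γ) (there i) with translate-c-move done Γ i
  ... | inj₁ e = inj₁ e
  ... | inj₂ (d , x , j , ab , ye) = inj₂ (d , x , there j , ab , ye)
  translate-c-move true ((env , d₁ , x₁) ∷ Γ) (here e) = ⊥-elim (relabelᶜ-not-c d₁ e)
  translate-c-move true ((env , d₁ , x₁) ∷ Γ) (there i) with translate-c-move true Γ i
  ... | inj₁ e = inj₁ e
  ... | inj₂ (d , x , j , ab , ye) = inj₂ (d , x , there j , ab , ye)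
  translate-c-move false ((env , d₁ , x₁) ∷ Γ) i with inAB d₁ in eq
  translate-c-move false ((env , d₁ , x₁) ∷ Γ) (here refl) | true =
    inj₂ (d₁ , x₁ , there (here refl) , eq , refl)
  translate-c-move false ((env , d₁ , x₁) ∷ Γ) (there (here e)) | true = ⊥-elim (relabelᶜ-not-c d₁ e)
  translate-c-move false ((env , d₁ , x₁) ∷ Γ) (there (there i)) | true with translate-c-move true Γ i
  ... | inj₁ e = inj₁ e
  ... | inj₂ (d , x , j , ab , ye) = inj₂ (d , x , there (there j) , ab , ye)
  translate-c-move false ((env , d₁ , x₁) ∷ Γ) (here e) | false = ⊥-elim (relabelᶜ-not-c d₁ e)
  translate-c-move false ((env , d₁ , x₁) ∷ Γ) (there i) | false with translate-c-move false Γ i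
  ... | inj₁ e = inj₁ e
  ... | inj₂ (d , x , j , ab , ye) = inj₂ (d , x , there j , ab , ye)

  translate-ab-move : ∀ Γ {d x} → (env , relabelᶜ d , x) ∈ translate false Γ → inAB d ≡ true →
    ∃[ y ] ((env , conj c , y) ∈ translate false Γ)
  translate-ab-move ((machine , m) ∷ Γ) (there i) ab with y , j ← translate-ab-move Γ i ab = y , there j
  translate-ab-move ((env , d₁ , x₁) ∷ Γ) i ab with inAB d₁ in eq
  ... | true = _ , here refl
  translate-ab-move ((env , d₁ , x₁) ∷ Γ) {d} (here e) ab | false
    with refl ← relabelᶜ-injective d d₁ (cong clusterOf e) with () ← trans (sym ab) eq
  translate-ab-move ((env , d₁ , x₁) ∷ Γ) (there i) ab | false
    with y , j ← translate-ab-move Γ i ab = y , there j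

  module _ (M : HPM) (e : ℕ → List Move) where

    translatedRun : ℕ → List LMove
    translatedRun t = translate false (run (simulator M) e t)

    Simulated Real : Resolution
    Simulated = Resolved (run M (simulatedEnv e))
    Real = Resolved (run (simulator M) e)

    to-translated : ∀ t {z} → z ∈ run M (simulatedEnv e) t → z ∈ translatedRun t
    to-translated t {z} = subst (z ∈_) (run-simulation M e t)

    from-translated : ∀ t {z} → z ∈ translatedRun t → z ∈ run M (simulatedEnv e) t
    from-translated t {z} = subst (z ∈_) (sym (run-simulation M e t))

    firstIllegal-simulation : ∀ t →
      firstIllegal [] (run M (simulatedEnv e) t) ≡ firstIllegal [] (run (simulator M) e t)
    firstIllegal-simulation t =
      trans (cong (firstIllegal []) (run-simulation M e t)) (firstIllegal-translate[] (run (simulator M) e t))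

    simulated-env-move : ∀ t {d x} → relabelᶜ d ≡ d →
      (env , relabelᶜ d , x) ∈ translatedRun t → Simulated d x
    simulated-env-move t {d} {x} fixed m =
      t , env , from-translated t (subst (λ d′ → (env , d′ , x) ∈ translatedRun t) fixed m)

    Resolved-simulation : ∀ {d} → relabelᶜ d ≡ d → d ≢ conj c → ∀ x → Simulated d x ⇔ Real d x
    Resolved-simulation {d} fixed d≢c x = mk⇔ to from
      where
      to : Simulated d x → Real d x
      to (t , p , m) with translate-∈⁻ false (run (simulator M) e t) (to-translated t m)
      to (t , machine , m) | inj₁ (_ , m₀ , refl) = t , machine , m₀
      to (t , env , m) | inj₁ (d₀ , m₀ , eq)
        with refl ← relabelᶜ-injective d₀ d (trans (sym eq) (sym fixed)) = t , env , m₀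
      to (t , p , m) | inj₂ (_ , eq) = ⊥-elim (d≢c eq)
      from : Real d x → Simulated d x
      from (t , machine , m) = t , machine , from-translated t (translate-∈⁺ false _ m)
      from (t , env , m) = simulated-env-move t fixed (translate-∈⁺ false _ m)

    module _ (legal : Legal (run M (simulatedEnv e)))
             (a-fixed : relabelᶜ (conj a) ≡ conj a) (b-fixed : relabelᶜ (conj b) ≡ conj b) where

      simulated-c₀⇒a : Simulated (conj c) false → ∃[ x ] Simulated (conj a) x
      simulated-c₀⇒a (t , p , m) with translate-c-move false (run (simulator M) e t) (to-translated t m)
      ... | inj₁ refl with () ← legal-owner (legal t) m
      ... | inj₂ (d , x , m′ , _ , value)
        with refl ← ==C⇒≡ d (conj a) (trans (sym (not-involutive _)) (cong not (sym value))) =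
        x , simulated-env-move t a-fixed m′

      simulated-c₁⇒b : Simulated (conj c) true → ∃[ x ] Simulated (conj b) x
      simulated-c₁⇒b (t , p , m) with translate-c-move false (run (simulator M) e t) (to-translated t m)
      ... | inj₁ refl with () ← legal-owner (legal t) m
      ... | inj₂ (d , x , m′ , d∈ab , value) with d ==C conj a
      ...   | true with () ← value
      ...   | false with refl ← ==C⇒≡ d (conj b) d∈ab = x , simulated-env-move t b-fixed m′

      simulated-¬c⇒¬ab : ¬ Simulated (conj c) false → ¬ Simulated (conj c) true →
        ∀ x → ¬ Simulated (conj a) x × ¬ Simulated (conj b) x
      simulated-¬c⇒¬ab ¬c₀ ¬c₁ x = unresolved a-fixed inAB-a , unresolved b-fixed inAB-b
        where
        unresolved : ∀ {k} → relabelᶜ (conj k) ≡ conj k → inAB (conj k) ≡ true → ¬ Simulated (conj k) x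
        unresolved _ _ (t , machine , m) with () ← legal-owner (legal t) m
        unresolved {k} fixed k∈ab (t , env , m)
          with translate-ab-move (run (simulator M) e t) {conj k}
                 (subst (λ d → (env , d , x) ∈ translatedRun t) (sym fixed) (to-translated t m)) k∈ab
        ... | false , c-move = ¬c₀ (t , env , from-translated t c-move)
        ... | true , c-move = ¬c₁ (t , env , from-translated t c-move)

module _ {I : ℕ → Bool} {R R′ : Resolution} where

  Won-resolution-cong : ∀ Y → (∀ d → Occurs d Y → ∀ x → R′ d x ⇔ R d x) → Won I R′ Y → Won I R Y
  Won-resolution-cong ⊤ᶜ _ w = w
  Won-resolution-cong (pos p) _ w = w
  Won-resolution-cong (neg p) _ w = w
  Won-resolution-cong (A ∨ᶜ B) h (inj₁ w) = inj₁ (Won-resolution-cong A (λ d → h d ∘ ∨l) w)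
  Won-resolution-cong (A ∨ᶜ B) h (inj₂ w) = inj₂ (Won-resolution-cong B (λ d → h d ∘ ∨r) w)
  Won-resolution-cong (A ∧ᶜ B) h (w , v) =
    Won-resolution-cong A (λ d → h d ∘ ∧l) w , Won-resolution-cong B (λ d → h d ∘ ∧r) v
  Won-resolution-cong (⊓ᶜ n A B) h (inj₁ (inj₁ (¬r₀ , ¬r₁))) =
    inj₁ (inj₁ (¬r₀ ∘ Equivalence.from (h _ here⊓ false) , ¬r₁ ∘ Equivalence.from (h _ here⊓ true)))
  Won-resolution-cong (⊓ᶜ n A B) h (inj₁ (inj₂ (r₀ , w))) =
    inj₁ (inj₂ (Equivalence.to (h _ here⊓ false) r₀ , Won-resolution-cong A (λ d → h d ∘ ⊓l) w))
  Won-resolution-cong (⊓ᶜ n A B) h (inj₂ (r₁ , w)) =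
    inj₂ (Equivalence.to (h _ here⊓ true) r₁ , Won-resolution-cong B (λ d → h d ∘ ⊓r) w)
  Won-resolution-cong (⊔ᶜ n A B) h (inj₁ (r₀ , w)) =
    inj₁ (Equivalence.to (h _ here⊔ false) r₀ , Won-resolution-cong A (λ d → h d ∘ ⊔l) w)
  Won-resolution-cong (⊔ᶜ n A B) h (inj₂ (r₁ , w)) =
    inj₂ (Equivalence.to (h _ here⊔ true) r₁ , Won-resolution-cong B (λ d → h d ∘ ⊔r) w)

module _ {I : ℕ → Bool} {R : Resolution} where

  resolved-somehow : ∀ {d} → ∃[ x ] R d x → ¬ R d false → ¬ R d true → ⊥
  resolved-somehow (false , r₀) ¬r₀ _ = ¬r₀ r₀
  resolved-somehow (true , r₁) _ ¬r₁ = ¬r₁ r₁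

  Won-quadrilemma⁻ : ∀ a b c A B E F →
    (R (conj c) false → ∃[ x ] R (conj a) x) → (R (conj c) true → ∃[ x ] R (conj b) x) →
    (¬ R (conj c) false → ¬ R (conj c) true → ∀ x → ¬ R (conj a) x × ¬ R (conj b) x) →
    Won I R (quadPrem a b c A B E F) → Won I R (⊓ᶜ a A B ∧ᶜ ⊓ᶜ b E F)
  Won-quadrilemma⁻ a b c A B E F _ _ ¬c⇒¬ab (inj₁ (inj₁ (¬c₀ , ¬c₁))) =
    inj₁ (inj₁ (proj₁ (¬c⇒¬ab ¬c₀ ¬c₁ false) , proj₁ (¬c⇒¬ab ¬c₀ ¬c₁ true))) ,
    inj₁ (inj₁ (proj₂ (¬c⇒¬ab ¬c₀ ¬c₁ false) , proj₂ (¬c⇒¬ab ¬c₀ ¬c₁ true)))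
  Won-quadrilemma⁻ a b c A B E F c₀⇒a _ _ (inj₁ (inj₂ (c₀ , inj₁ (inj₁ (¬a₀ , ¬a₁))))) =
    ⊥-elim (resolved-somehow (c₀⇒a c₀) ¬a₀ ¬a₁)
  Won-quadrilemma⁻ a b c A B E F _ _ _ (inj₁ (inj₂ (_ , inj₁ (inj₂ (a₀ , wA , wEF))))) =
    inj₁ (inj₂ (a₀ , wA)) , wEF
  Won-quadrilemma⁻ a b c A B E F _ _ _ (inj₁ (inj₂ (_ , inj₂ (a₁ , wB , wEF)))) = inj₂ (a₁ , wB) , wEF
  Won-quadrilemma⁻ a b c A B E F _ c₁⇒b _ (inj₂ (c₁ , inj₁ (inj₁ (¬b₀ , ¬b₁)))) =
    ⊥-elim (resolved-somehow (c₁⇒b c₁) ¬b₀ ¬b₁)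
  Won-quadrilemma⁻ a b c A B E F _ _ _ (inj₂ (_ , inj₁ (inj₂ (b₀ , wAB , wE)))) = wAB , inj₁ (inj₂ (b₀ , wE))
  Won-quadrilemma⁻ a b c A B E F _ _ _ (inj₂ (_ , inj₂ (b₁ , wAB , wF))) = wAB , inj₂ (b₁ , wF)

Step6-Valid⁻ : ∀ {D D′} → Step6 D D′ → Valid D′ → Valid D
Step6-Valid⁻ (st X a b c A B E F c∉D) (M , sol) = simulator M , solves
  where
  D : Cirq
  D = splug X (⊓ᶜ a A B ∧ᶜ ⊓ᶜ b E F)
  N : ℕ
  N = suc (conjBound D + c)
  c<N : c < N
  c<N = s≤s (m≤n+m c (conjBound D))
  open QuadrilemmaSimulation a b c N c<N
  fixed : ∀ {d} → Occurs d D → relabelᶜ d ≡ d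
  fixed {disj n} _ = refl
  fixed {conj n} o = cong conj (relabel-fixes n (s≤s (≤-trans (<⇒≤ (Occurs⇒<conjBound o)) (m≤m+n _ c)))
    λ { refl → c∉D o })
  ≢c : ∀ {d} → Occurs d D → d ≢ conj c
  ≢c o refl = c∉D o
  solves : ∀ I → Solves (simulator M) D I
  solves I e with sol I (simulatedEnv e)
  ... | inj₁ (t , illegal) = inj₁ (t , trans (sym (firstIllegal-simulation M e t)) illegal)
  ... | inj₂ (legal , won) = inj₂ ((λ t → trans (sym (firstIllegal-simulation M e t)) (legal t)) ,
    Won-resolution-cong D (λ d o → Resolved-simulation M e (fixed o) (≢c o))
      (Won-splug X (Won-quadrilemma⁻ a b c A B E F (simulated-c₀⇒a M e legal a-fixed b-fixed)
        (simulated-c₁⇒b M e legal a-fixed b-fixed) (simulated-¬c⇒¬ab M e legal a-fixed b-fixed)) won))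
    where
    a-fixed : relabelᶜ (conj a) ≡ conj a
    a-fixed = fixed (Occurs-splug X (∧l here⊓))
    b-fixed : relabelᶜ (conj b) ≡ conj b
    b-fixed = fixed (Occurs-splug X (∧r here⊓))

purification-preserves-Valid : PurificationSteps _≈ᵛ_
purification-preserves-Valid = record
  { ∼-refl = ⇔-refl
  ; ∼-trans = ⇔-trans
  ; step1a = SurfRw⇒≈ᵛ (λ { (l A) _ _ _ _ (inj₂ w) → w ; (r A) _ _ _ _ (inj₁ w) → w })
                       (λ { (l A) _ _ _ _ w → inj₂ w ; (r A) _ _ _ _ w → inj₁ w })
  ; step1b = SurfRw⇒≈ᵛ (λ { (l A) _ _ _ _ (() , _) ; (r A) _ _ _ _ (_ , ()) })
                       (λ { (l A) _ _ _ _ () ; (r A) _ _ _ _ () })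
  ; step2 = SurfRw⇒≈ᵛ (λ { (l A B C) _ _ _ _ → [ (λ (a , b) → inj₁ a , inj₁ b) , (λ c → inj₂ c , inj₂ c) ]′
                         ; (r A B C) _ _ _ _ → [ (λ c → inj₂ c , inj₂ c) , (λ (a , b) → inj₁ a , inj₁ b) ]′ })
                      (λ { (l A B C) _ _ _ _ (inj₁ a , inj₁ b) → inj₁ (a , b)
                         ; (l A B C) _ _ _ _ (inj₂ c , _) → inj₂ c
                         ; (l A B C) _ _ _ _ (_ , inj₂ c) → inj₂ c
                         ; (r A B C) _ _ _ _ (inj₁ a , inj₁ b) → inj₂ (a , b)
                         ; (r A B C) _ _ _ _ (inj₂ c , _) → inj₁ c
                         ; (r A B C) _ _ _ _ (_ , inj₂ c) → inj₁ c })
  ; step3 = SurfRw⇒≈ᵛ (λ { (l c A B C) _ _ _ dec → Won-⊓∨-distrib c A B C (dec c)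
                         ; (r c A B C) _ _ _ dec →
                             Won-⊓∨-distrib c A B C (dec c) ∘ Won-∨-swap {A = C} {⊓ᶜ c A B} })
                      (λ { (l c A B C) _ _ _ _ → Won-⊓∨-factor c A B C
                         ; (r c A B C) _ _ _ _ → Won-∨-swap {A = ⊓ᶜ c A B} {C} ∘ Won-⊓∨-factor c A B C })
  ; step4 = SurfRw⇒≈ᵛ (λ { (tr E p _ _) _ _ _ _ _ → tt })
                      (λ { (tr E p v⁺ v⁻) _ _ _ _ _ → Won-complementary v⁺ v⁻ })
  ; step5a = SurfRw⇒≈ᵛ (λ { (l A) _ _ _ _ _ → tt ; (r A) _ _ _ _ _ → tt })
                       (λ { (l A) _ _ _ _ _ → inj₁ tt ; (r A) _ _ _ _ _ → inj₂ tt })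
  ; step5b = SurfRw⇒≈ᵛ (λ { (l A) _ _ _ _ → proj₂ ; (r A) _ _ _ _ → proj₁ })
                       (λ { (l A) _ _ _ _ w → tt , w ; (r A) _ _ _ _ w → w , tt })
  ; step6 = λ { s@(st X a b c A B E F _) → mk⇔
      (TruthTransfer⇒Valid λ _ _ _ dec → Won-splug X (Won-quadrilemma⁺ a b c A B E F (dec c)))
      (Step6-Valid⁻ s) }
  ; step7a = Step7a-≈ᵛ
  ; step7b = Step7b-≈ᵛ
  }

lemma7p5 : ∀ (A B : Cirq) → Purification A B →
    (Prov B → Prov A)
    × ((Valid A → Valid B) × (Valid B → Valid A))
    × Pure B
    × rank B ≤ rank A
lemma7p5 A B purification =
  purification⇒ purification-reflects-Prov purification ,
  (Equivalence.to A≈ᵛB , Equivalence.from A≈ᵛB) ,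
  purification-Pure purification ,
  purification⇒ purification-decreases-rank purification
  where
  A≈ᵛB : A ≈ᵛ B
  A≈ᵛB = purification⇒ purification-preserves-Valid purification
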